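{- Let $\mathbb P=(P,\le,\Delta,f)$ be the syntactic forcing property over an at most countable transition-algebra signature $\Sigma$. For all conditions $p\in P$ and all sentences $\phi\in\mathrm{Sen}(\Delta_p)$: $p\Vdash^w\phi$ if and only if $\Gamma_p\vdash_{\Delta_p}\phi$.
   Context: Transition algebra (TA). A signature $\Sigma=(S,F\supseteq M,L)$ consists of sorts $S$, function symbols $F$ (constants have empty arity), monotonic function symbols $M\subseteq F$ and transition labels $L$; it is at most countable if $S,F,L$ are. Actions: $\mathfrak a::=\lambda\mid\mathfrak a\mathbin{;}\mathfrak a\mid\mathfrak a\cup\mathfrak a\mid\mathfrak a^*$ ($\lambda\in L$); $\mathfrak a^n$ is the $n$-fold composition (for $n=0$, $t_1\stackrel{\mathfrak a^0}\Rightarrow t_2$ is read as $t_1=t_2$). $\Sigma$-sentences: $\phi::=t_1=t_2\mid t_1\stackrel{\mathfrak a}\Rightarrow t_2\mid\neg\phi\mid\bigvee\Phi\mid\exists X\,\phi'$ (ground terms of equal sort, finite $\Phi$, finite variable set $X$ added as new constants giving $\Sigma[X]$, $\phi'\in\mathrm{Sen}(\Sigma[X])$); $\bot:=\bigvee\emptyset$. $T_\Sigma$: ground terms; substitutions $\theta\colon X\to T_\Sigma$ act on sentences. Atomic sentences: $t_1=t_2$, $t_1\stackrel{\lambda}\Rightarrow t_2$ ($\lambda\in L$), forming $\mathrm{Sen}_b(\Sigma)$. Models: many-sorted algebras (possibly empty carriers) with label relations, monotone for $M$; usual satisfaction. Dynamic entailment $\vdash$: the least family $\vdash_\Sigma\subseteq\mathcal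 P(\mathrm{Sen}(\Sigma))^2$ closed under Monotonicity, Transitivity, Union, Translation along signature morphisms, and the rules: (R) $\Gamma\vdash t=t$; (S),(T) symmetry/transitivity of $=$; (F) congruence for function symbols; (P) $\Gamma\vdash t_1=t_1'$, $\Gamma\vdash t_2=t_2'$, $\Gamma\vdash t_1\stackrel{\lambda}\Rightarrow t_2$ give $\Gamma\vdash t_1'\stackrel{\lambda}\Rightarrow t_2'$; (M) for $f\in M$, $\Gamma\vdash t_j\stackrel{\lambda}\Rightarrow u_j$ gives $\Gamma\vdash f(\dots,t_j,\dots)\stackrel{\lambda}\Rightarrow f(\dots,u_j,\dots)$; (Comp$_I$) from $t_1\stackrel{\mathfrak a_1}\Rightarrow t$ and $t\stackrel{\mathfrak a_2}\Rightarrow t_2$ infer $t_1\stackrel{\mathfrak a_1;\mathfrak a_2}\Rightarrow t_2$; (Comp$_E$) if $\Gamma\vdash_\Sigma t_1\stackrel{\mathfrak a_1;\mathfrak a_2}\Rightarrow t_2$ and $\Gamma\cup\{t_1\stackrel{\mathfrak a_1}\Rightarrow x,x\stackrel{\mathfrak a_2}\Rightarrow t_2\}\vdash_{\Sigma[x]}\phi$ ($x$ new constant) then $\Gamma\vdash_\Sigma\phi$; (Union$_I$) from $t_1\stackrel{\mathfrak a_i}\Rightarrow t_2$ infer $t_1\stackrel{\mathfrak a_1\cup\mathfrak a_2}\Rightarrow t_2$; (Union$_E$) if $\Gamma\vdash t_1\stackrel{\mathfrak a_1\cup\mathfrak a_2}\Rightarrow t_2$ and $\Gamma\cup\{t_1\stackrel{\mathfrak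 a_i}\Rightarrow t_2\}\vdash\phi$ for $i=1,2$ then $\Gamma\vdash\phi$; (Star$_I$) from $t_1\stackrel{\mathfrak a^n}\Rightarrow t_2$ infer $t_1\stackrel{\mathfrak a^*}\Rightarrow t_2$; (Star$_E$) if $\Gamma\vdash t_1\stackrel{\mathfrak a^*}\Rightarrow t_2$ and $\Gamma\cup\{t_1\stackrel{\mathfrak a^n}\Rightarrow t_2\}\vdash\phi$ for all $n\in\omega$ then $\Gamma\vdash\phi$; (Neg$_D$) $\neg\neg\phi\vdash$-to-$\phi$; (False) from $\bot$ anything; (Neg$_I$) $\Gamma\cup\{\phi\}\vdash\bot$ gives $\Gamma\vdash\neg\phi$; (Neg$_E$) $\Gamma\vdash\neg\phi$ gives $\Gamma\cup\{\phi\}\vdash\bot$; (Disj$_I$) $\Gamma\vdash\phi$, $\phi\in\Phi$ give $\Gamma\vdash\bigvee\Phi$; (Disj$_E$) $\Gamma\vdash\bigvee\Phi$ and $\Gamma\cup\{\phi\}\vdash\gamma$ for all $\phi\in\Phi$ give $\Gamma\vdash\gamma$; (Quant$_I$) $\Gamma\cup\{\phi\}\vdash_{\Sigma[X]}\gamma$ gives $\Gamma\cup\{\exists X\phi\}\vdash_\Sigma\gamma$; (Quant$_E$) the converse; (Subst) $\Gamma\vdash_\Sigma\theta(\phi)$ gives $\Gamma\vdash_\Sigma\exists X\phi$. Syntactic forcing property over $\Sigma$: fix an $S$-sorted set $C$ of new constants with $C_s$ countably infinite for each $s$. $P$ is the set of pairs $p=(\Delta_p,\Gamma_p)$ where $\Delta_p$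 is $\Sigma$ extended with a finite set $C_p\subseteq C$ of constants and $\Gamma_p\subseteq\mathrm{Sen}(\Delta_p)$ with $\Gamma_p\not\vdash_{\Delta_p}\bot$; $p\le q$ iff $\Delta_p\subseteq\Delta_q$ and $\Gamma_p\subseteq\Gamma_q$; $\Delta(p)=\Delta_p$; $f(p)=\Gamma_p\cap\mathrm{Sen}_b(\Delta_p)$. Forcing relation on this $\mathbb P$: $p\Vdash\varphi$ iff $\varphi\in f(p)$ (atomic); $p\Vdash t_1\stackrel{\mathfrak a_1;\mathfrak a_2}\Rightarrow t_2$ iff $p\Vdash t_1\stackrel{\mathfrak a_1}\Rightarrow t$ and $p\Vdash t\stackrel{\mathfrak a_2}\Rightarrow t_2$ for some $t\in T_{\Delta_p}$; $p\Vdash t_1\stackrel{\mathfrak a_1\cup\mathfrak a_2}\Rightarrow t_2$ iff $p$ forces one of $t_1\stackrel{\mathfrak a_i}\Rightarrow t_2$; $p\Vdash t_1\stackrel{\mathfrak a^*}\Rightarrow t_2$ iff $p\Vdash t_1\stackrel{\mathfrak a^n}\Rightarrow t_2$ for some $n$; $p\Vdash\neg\phi$ iff no $q\ge p$ forces $\phi$; $p\Vdash\bigvee\Phi$ iff $p$ forces some $\phi\in\Phi$; $p\Vdash\exists X\phi$ iff $p\Vdash\theta(\phi)$ for some $\theta\colon X\to T_{\Delta_p}$. Weak forcing: $p\Vdash^w\phi$ iff $p\Vdash\neg\neg\phi$. -}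

module Defs where

open import Level using (Level; Lift; lift) renaming (suc to lsuc; zero to lzero)
open import Data.Nat using (ℕ; zero; suc)
open import Data.Bool using (Bool; T)
open import Data.Empty using (⊥)
open import Data.Unit using (⊤)
open import Data.Product using (Σ; _×_; _,_; proj₁; proj₂)
open import Data.Sum using (_⊎_; inj₁; inj₂)
open import Data.List using (List; []; _∷_; map)
open import Data.List.Membership.Propositional using (_∈_)
open import Data.List.Membership.Propositional.Properties using (∈-map⁺)
open import Data.List.Relation.Unary.Any using (Any; here; there)
open import Relation.Nullary using (¬_)
open import Relation.Binary.PropositionalEquality using (_≡_; refl; cong)
open import Function.Definitions using (Injective)

record Ops (S L : Set) : Set₁ where
  field
    F : List S → S → Set
    M : ∀ {w s} → F w s → Set          -- monotonic symbols M ⊆ F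
open Ops public

record Sig : Set₁ where
  field
    S   : Set
    L   : Set
    ops : Ops S L
open Sig public

Countable : Set → Set
Countable A = Σ (A → ℕ) (λ f → Injective _≡_ _≡_ f)

AtMostCountable : Sig → Set
AtMostCountable Σ' =
  Countable (S Σ')
  × Countable (Σ (List (S Σ')) (λ w → Σ (S Σ') (λ s → F (ops Σ') w s)))
  × Countable (L Σ')

module _ {S L : Set} where

  mutual
    data Term (O : Ops S L) : S → Set where
      op : ∀ {w s} → F O w s → Terms O w → Term O s

    data Terms (O : Ops S L) : List S → Set where
      []  : Terms O []
      _∷_ : ∀ {s w} → Term O s → Terms O w → Terms O (s ∷ w)

  lookupT : ∀ {O w s} → Terms O w → s ∈ w → Term O s
  lookupT (t ∷ ts) (here refl) = t
  lookupT (t ∷ ts) (there i)   = lookupT ts i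

  updateT : ∀ {O w s} → Terms O w → s ∈ w → Term O s → Terms O w
  updateT (t ∷ ts) (here refl) u = u ∷ ts
  updateT (t ∷ ts) (there i)   u = t ∷ updateT ts i u

  -- Σ[X] : Σ extended with the (finite, sorted) set of new constants X
  -- (X is a list of sorts; the positions of X are the variables)
  _[_] : Ops S L → List S → Ops S L
  O [ X ] = record
    { F = λ w s → F O w s ⊎ (w ≡ [] × s ∈ X)
    ; M = λ { (inj₁ f) → M O f ; (inj₂ _) → ⊥ } }

data Act (L : Set) : Set where
  lab  : L → Act L
  _⨟_  : Act L → Act L → Act L
  _∪ₐ_ : Act L → Act L → Act L
  _⋆   : Act L → Act L

-- a ^ (n+1) :  a^1 = a,  a^(n+2) = a^(n+1) ⨟ a
actPow : ∀ {L} → Act L → ℕ → Act L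
actPow a zero    = a
actPow a (suc n) = actPow a n ⨟ a

data Sen {S L : Set} : Ops S L → Set₁ where
  _≐_    : ∀ {O s} → Term O s → Term O s → Sen O
  _⇒⟨_⟩_ : ∀ {O s} → Term O s → Act L → Term O s → Sen O
  ¬ₛ_    : ∀ {O} → Sen O → Sen O
  ⋁ₛ     : ∀ {O} → List (Sen O) → Sen O
  ∃ₛ     : ∀ {O} (X : List S) → Sen (O [ X ]) → Sen O

module _ {S L : Set} where

  ⊥ₛ : ∀ {O : Ops S L} → Sen O
  ⊥ₛ = ⋁ₛ []

  transPow : ∀ {O : Ops S L} {s} → Term O s → Act L → ℕ → Term O s → Sen O
  transPow t₁ a zero    t₂ = t₁ ≐ t₂
  transPow t₁ a (suc n) t₂ = t₁ ⇒⟨ actPow a n ⟩ t₂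

  data Atomic {O : Ops S L} : Sen O → Set₁ where
    at-eq  : ∀ {s} (t₁ t₂ : Term O s) → Atomic (t₁ ≐ t₂)
    at-lab : ∀ {s} (t₁ t₂ : Term O s) (l : L) → Atomic (t₁ ⇒⟨ lab l ⟩ t₂)

-- Sort/label-preserving maps that send symbols to symbols and constants
-- possibly to ground terms (used for inclusions Σ ↪ Σ[X] and
-- substitutions θ : X → T_Σ).

  IMor : Ops S L → Ops S L → Set
  IMor O₁ O₂ = ∀ {w s} → F O₁ w s → F O₂ w s ⊎ (w ≡ [] × Term O₂ s)

  mutual
    trT : ∀ {O₁ O₂ s} → IMor O₁ O₂ → Term O₁ s → Term O₂ s
    trT μ (op f ts) with μ f
    ... | inj₁ g          = op g (trTs μ ts)
    ... | inj₂ (refl , t) = t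

    trTs : ∀ {O₁ O₂ w} → IMor O₁ O₂ → Terms O₁ w → Terms O₂ w
    trTs μ []       = []
    trTs μ (t ∷ ts) = trT μ t ∷ trTs μ ts

  idI : ∀ {O} → IMor O O
  idI f = inj₁ f

  ιI : ∀ {O} (X : List S) → IMor O (O [ X ])
  ιI X f = inj₁ (inj₁ f)

  _⨾_ : ∀ {O₁ O₂ O₃} → IMor O₁ O₂ → IMor O₂ O₃ → IMor O₁ O₃
  (μ ⨾ ν) f with μ f
  ... | inj₁ g       = ν g
  ... | inj₂ (e , t) = inj₂ (e , trT ν t)

  extI : ∀ {O₁ O₂} (X : List S) → IMor O₁ O₂ → IMor (O₁ [ X ]) (O₂ [ X ])
  extI X μ (inj₁ f) with μ f
  ... | inj₁ g       = inj₁ (inj₁ g)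
  ... | inj₂ (e , t) = inj₂ (e , trT (ιI X) t)
  extI X μ (inj₂ x) = inj₁ (inj₂ x)

  Subst : List S → Ops S L → Set
  Subst X O = ∀ {s} → s ∈ X → Term O s

  withSubst : ∀ {O₁ O₂} (X : List S) → IMor O₁ O₂ → Subst X O₂ → IMor (O₁ [ X ]) O₂
  withSubst X μ θ (inj₁ f)       = μ f
  withSubst X μ θ (inj₂ (e , x)) = inj₂ (e , θ x)

  mutual
    trS : ∀ {O₁ O₂} → IMor O₁ O₂ → Sen O₁ → Sen O₂
    trS μ (t₁ ≐ t₂)     = trT μ t₁ ≐ trT μ t₂
    trS μ (t₁ ⇒⟨ a ⟩ t₂) = trT μ t₁ ⇒⟨ a ⟩ trT μ t₂
    trS μ (¬ₛ φ)        = ¬ₛ trS μ φ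
    trS μ (⋁ₛ Φ)        = ⋁ₛ (trSs μ Φ)
    trS {O₁} {O₂} μ (∃ₛ X φ) = ∃ₛ X (trS (extI {O₁ = O₁} {O₂ = O₂} X μ) φ)

    trSs : ∀ {O₁ O₂} → IMor O₁ O₂ → List (Sen O₁) → List (Sen O₂)
    trSs μ []       = []
    trSs μ (φ ∷ Φ) = trS μ φ ∷ trSs μ Φ

  applySubst : ∀ {O} (X : List S) → Subst X O → Sen (O [ X ]) → Sen O
  applySubst {O} X θ = trS (withSubst {O₁ = O} {O₂ = O} X idI θ)

  SenSet : Ops S L → Set₂
  SenSet O = Sen O → Set₁

  _∪｛_｝ : ∀ {O} → SenSet O → Sen O → SenSet O
  (Γ ∪｛ φ ｝) ψ = Γ ψ ⊎ ψ ≡ φ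

  ｛_｝ : ∀ {O} → Sen O → SenSet O
  ｛ φ ｝ ψ = ψ ≡ φ

  imageI : ∀ {O₁ O₂} → IMor O₁ O₂ → SenSet O₁ → SenSet O₂
  imageI μ Γ ψ = Σ (Sen _) (λ γ → Γ γ × trS μ γ ≡ ψ)

record SigMor {S₁ L₁ S₂ L₂ : Set} (O₁ : Ops S₁ L₁) (O₂ : Ops S₂ L₂) : Set where
  field
    σS : S₁ → S₂
    σL : L₁ → L₂
    σF : ∀ {w s} → F O₁ w s → F O₂ (map σS w) (σS s)
    σM : ∀ {w s} {f : F O₁ w s} → M O₁ f → M O₂ (σF f)
open SigMor public

module _ {S₁ L₁ S₂ L₂ : Set} where

  mutual
    trTg : ∀ {O₁ : Ops S₁ L₁} {O₂ : Ops S₂ L₂} {s} (σ : SigMor O₁ O₂)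
         → Term O₁ s → Term O₂ (σS σ s)
    trTg σ (op f ts) = op (σF σ f) (trTsg σ ts)

    trTsg : ∀ {O₁ : Ops S₁ L₁} {O₂ : Ops S₂ L₂} {w} (σ : SigMor O₁ O₂)
          → Terms O₁ w → Terms O₂ (map (σS σ) w)
    trTsg σ []       = []
    trTsg σ (t ∷ ts) = trTg σ t ∷ trTsg σ ts

  trA : (L₁ → L₂) → Act L₁ → Act L₂
  trA g (lab l)  = lab (g l)
  trA g (a ⨟ b)  = trA g a ⨟ trA g b
  trA g (a ∪ₐ b) = trA g a ∪ₐ trA g b
  trA g (a ⋆)    = trA g a ⋆

  extG : ∀ {O₁ : Ops S₁ L₁} {O₂ : Ops S₂ L₂} (X : List S₁) (σ : SigMor O₁ O₂)
       → SigMor (O₁ [ X ]) (O₂ [ map (σS σ) X ])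
  extG X σ = record
    { σS = σS σ
    ; σL = σL σ
    ; σF = λ { (inj₁ f) → inj₁ (σF σ f)
             ; (inj₂ (e , x)) → inj₂ (cong (map (σS σ)) e , ∈-map⁺ (σS σ) x) }
    ; σM = λ { {f = inj₁ f} m → σM σ m ; {f = inj₂ _} () } }

  mutual
    trSg : ∀ {O₁ : Ops S₁ L₁} {O₂ : Ops S₂ L₂} (σ : SigMor O₁ O₂) → Sen O₁ → Sen O₂
    trSg σ (t₁ ≐ t₂)      = trTg σ t₁ ≐ trTg σ t₂
    trSg σ (t₁ ⇒⟨ a ⟩ t₂) = trTg σ t₁ ⇒⟨ trA (σL σ) a ⟩ trTg σ t₂
    trSg σ (¬ₛ φ)         = ¬ₛ trSg σ φ
    trSg σ (⋁ₛ Φ)         = ⋁ₛ (trSsg σ Φ)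
    trSg σ (∃ₛ X φ)       = ∃ₛ (map (σS σ) X) (trSg (extG X σ) φ)

    trSsg : ∀ {O₁ : Ops S₁ L₁} {O₂ : Ops S₂ L₂} (σ : SigMor O₁ O₂)
          → List (Sen O₁) → List (Sen O₂)
    trSsg σ []      = []
    trSsg σ (φ ∷ Φ) = trSg σ φ ∷ trSsg σ Φ

  imageG : ∀ {O₁ : Ops S₁ L₁} {O₂ : Ops S₂ L₂} → SigMor O₁ O₂ → SenSet O₁ → SenSet O₂
  imageG σ Γ ψ = Σ (Sen _) (λ γ → Γ γ × trSg σ γ ≡ ψ)

-- Dynamic entailment: the least family ⊢_Σ closed under the rules.
-- (Γ ⊢ E for a set E is read as: Γ ⊢ e for every e ∈ E; the Union rule is
-- then built in.)

infix 4 _⊢_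

data _⊢_ : {S L : Set} {O : Ops S L} → SenSet O → Sen O → Set₂ where
  mono   : ∀ {S L} {O : Ops S L} {Γ : SenSet O} {φ} → Γ φ → Γ ⊢ φ
  trans  : ∀ {S L} {O : Ops S L} {Γ E : SenSet O} {φ}
         → (∀ e → E e → Γ ⊢ e) → E ⊢ φ → Γ ⊢ φ
  transl : ∀ {S₁ L₁ S₂ L₂} {O₁ : Ops S₁ L₁} {O₂ : Ops S₂ L₂}
             (σ : SigMor O₁ O₂) {Γ : SenSet O₁} {φ}
         → Γ ⊢ φ → imageG σ Γ ⊢ trSg σ φ
  R      : ∀ {S L} {O : Ops S L} {Γ : SenSet O} {s} (t : Term O s) → Γ ⊢ t ≐ t
  Sy     : ∀ {S L} {O : Ops S L} {Γ : SenSet O} {s} {t₁ t₂ : Term O s}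
         → Γ ⊢ t₁ ≐ t₂ → Γ ⊢ t₂ ≐ t₁
  Tr     : ∀ {S L} {O : Ops S L} {Γ : SenSet O} {s} {t₁ t₂ t₃ : Term O s}
         → Γ ⊢ t₁ ≐ t₂ → Γ ⊢ t₂ ≐ t₃ → Γ ⊢ t₁ ≐ t₃
  Fc     : ∀ {S L} {O : Ops S L} {Γ : SenSet O} {w s} (f : F O w s) (ts us : Terms O w)
         → (∀ {s'} (i : s' ∈ w) → Γ ⊢ lookupT ts i ≐ lookupT us i)
         → Γ ⊢ op f ts ≐ op f us
  Pr     : ∀ {S L} {O : Ops S L} {Γ : SenSet O} {s} {t₁ t₁' t₂ t₂' : Term O s} {l : L}
         → Γ ⊢ t₁ ≐ t₁' → Γ ⊢ t₂ ≐ t₂' → Γ ⊢ t₁ ⇒⟨ lab l ⟩ t₂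
         → Γ ⊢ t₁' ⇒⟨ lab l ⟩ t₂'
  Mo     : ∀ {S L} {O : Ops S L} {Γ : SenSet O} {w s s'} (f : F O w s) → M O f
         → (ts : Terms O w) (j : s' ∈ w) (u : Term O s') {l : L}
         → Γ ⊢ lookupT ts j ⇒⟨ lab l ⟩ u
         → Γ ⊢ op f ts ⇒⟨ lab l ⟩ op f (updateT ts j u)
  CompI  : ∀ {S L} {O : Ops S L} {Γ : SenSet O} {s} {t₁ t t₂ : Term O s} {a₁ a₂ : Act L}
         → Γ ⊢ t₁ ⇒⟨ a₁ ⟩ t → Γ ⊢ t ⇒⟨ a₂ ⟩ t₂ → Γ ⊢ t₁ ⇒⟨ a₁ ⨟ a₂ ⟩ t₂
  CompE  : ∀ {S L} {O : Ops S L} {Γ : SenSet O} {s} {t₁ t₂ : Term O s} {a₁ a₂ : Act L} {φ}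
         → Γ ⊢ t₁ ⇒⟨ a₁ ⨟ a₂ ⟩ t₂
         → let ι = ιI {O = O} (s ∷ [])
               x = op (inj₂ (refl , here refl)) []
           in ((imageI ι Γ ∪｛ trT ι t₁ ⇒⟨ a₁ ⟩ x ｝) ∪｛ x ⇒⟨ a₂ ⟩ trT ι t₂ ｝) ⊢ trS ι φ
         → Γ ⊢ φ
  UnionI₁ : ∀ {S L} {O : Ops S L} {Γ : SenSet O} {s} {t₁ t₂ : Term O s} {a₁ a₂ : Act L}
          → Γ ⊢ t₁ ⇒⟨ a₁ ⟩ t₂ → Γ ⊢ t₁ ⇒⟨ a₁ ∪ₐ a₂ ⟩ t₂
  UnionI₂ : ∀ {S L} {O : Ops S L} {Γ : SenSet O} {s} {t₁ t₂ : Term O s} {a₁ a₂ : Act L}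
          → Γ ⊢ t₁ ⇒⟨ a₂ ⟩ t₂ → Γ ⊢ t₁ ⇒⟨ a₁ ∪ₐ a₂ ⟩ t₂
  UnionE  : ∀ {S L} {O : Ops S L} {Γ : SenSet O} {s} {t₁ t₂ : Term O s} {a₁ a₂ : Act L} {φ}
          → Γ ⊢ t₁ ⇒⟨ a₁ ∪ₐ a₂ ⟩ t₂
          → (Γ ∪｛ t₁ ⇒⟨ a₁ ⟩ t₂ ｝) ⊢ φ → (Γ ∪｛ t₁ ⇒⟨ a₂ ⟩ t₂ ｝) ⊢ φ
          → Γ ⊢ φ
  StarI  : ∀ {S L} {O : Ops S L} {Γ : SenSet O} {s} {t₁ t₂ : Term O s} {a : Act L} (n : ℕ)
         → Γ ⊢ transPow t₁ a n t₂ → Γ ⊢ t₁ ⇒⟨ a ⋆ ⟩ t₂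
  StarE  : ∀ {S L} {O : Ops S L} {Γ : SenSet O} {s} {t₁ t₂ : Term O s} {a : Act L} {φ}
         → Γ ⊢ t₁ ⇒⟨ a ⋆ ⟩ t₂
         → (∀ n → (Γ ∪｛ transPow t₁ a n t₂ ｝) ⊢ φ)
         → Γ ⊢ φ
  NegD   : ∀ {S L} {O : Ops S L} {φ : Sen O} → ｛ ¬ₛ ¬ₛ φ ｝ ⊢ φ
  False  : ∀ {S L} {O : Ops S L} {φ : Sen O} → ｛ ⊥ₛ ｝ ⊢ φ
  NegI   : ∀ {S L} {O : Ops S L} {Γ : SenSet O} {φ}
         → (Γ ∪｛ φ ｝) ⊢ ⊥ₛ → Γ ⊢ ¬ₛ φ
  NegE   : ∀ {S L} {O : Ops S L} {Γ : SenSet O} {φ}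
         → Γ ⊢ ¬ₛ φ → (Γ ∪｛ φ ｝) ⊢ ⊥ₛ
  DisjI  : ∀ {S L} {O : Ops S L} {Γ : SenSet O} {φ} {Φ : List (Sen O)}
         → Γ ⊢ φ → φ ∈ Φ → Γ ⊢ ⋁ₛ Φ
  DisjE  : ∀ {S L} {O : Ops S L} {Γ : SenSet O} {Φ : List (Sen O)} {γ}
         → Γ ⊢ ⋁ₛ Φ → (∀ φ → φ ∈ Φ → (Γ ∪｛ φ ｝) ⊢ γ) → Γ ⊢ γ
  QuantI : ∀ {S L} {O : Ops S L} {Γ : SenSet O} {X : List S} {φ : Sen (O [ X ])} {γ}
         → (imageI (ιI X) Γ ∪｛ φ ｝) ⊢ trS (ιI X) γ → (Γ ∪｛ ∃ₛ X φ ｝) ⊢ γ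
  QuantE : ∀ {S L} {O : Ops S L} {Γ : SenSet O} {X : List S} {φ : Sen (O [ X ])} {γ}
         → (Γ ∪｛ ∃ₛ X φ ｝) ⊢ γ → (imageI (ιI X) Γ ∪｛ φ ｝) ⊢ trS (ιI X) γ
  SubstR : ∀ {S L} {O : Ops S L} {Γ : SenSet O} {X : List S} {φ : Sen (O [ X ])}
             (θ : Subst X O)
         → Γ ⊢ applySubst X θ φ → Γ ⊢ ∃ₛ X φ

-- The syntactic forcing property over Σ.
-- New constants: C_s = ℕ for every sort s.  A finite C_p ⊆ C is given by
-- its (decidable) characteristic function with a finite support list.

module Forcing {S L : Set} (O : Ops S L) where

  Δ : (S → ℕ → Bool) → Ops S L
  Δ Cp = record
    { F = λ w s → F O w s ⊎ (w ≡ [] × Σ ℕ (λ n → T (Cp s n)))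
    ; M = λ { (inj₁ f) → M O f ; (inj₂ _) → ⊥ } }

  record Cond : Set₂ where
    field
      Cp     : S → ℕ → Bool
      Cp-fin : Σ (List (S × ℕ)) (λ xs → ∀ s n → T (Cp s n) → (s , n) ∈ xs)
      Γ      : SenSet (Δ Cp)
      consis : ¬ (Γ ⊢ ⊥ₛ)
  open Cond public

  Δp : Cond → Ops S L
  Δp p = Δ (Cp p)

  fP : (p : Cond) → SenSet (Δp p)
  fP p φ = Γ p φ × Atomic φ

  inclC : ∀ {C₁ C₂ : S → ℕ → Bool} → (∀ s n → T (C₁ s n) → T (C₂ s n))
        → IMor (Δ C₁) (Δ C₂)
  inclC sub (inj₁ f)                   = inj₁ (inj₁ f)
  inclC sub {s = s} (inj₂ (e , n , c)) = inj₁ (inj₂ (e , n , sub s n c))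

  record _≼_ (p q : Cond) : Set₁ where
    field
      sub : ∀ s n → T (Cp p s n) → T (Cp q s n)
      sup : ∀ γ → Γ p γ → Γ q (trS (inclC sub) γ)
  open _≼_ public

  incl : ∀ {p q} → p ≼ q → IMor (Δp p) (Δp q)
  incl e = inclC (sub e)

  mutual
    FTr : (q : Cond) {s : S} → Term (Δp q) s → Act L → Term (Δp q) s → Set₁
    FTr q t₁ (lab l)  t₂ = fP q (t₁ ⇒⟨ lab l ⟩ t₂)
    FTr q t₁ (a ⨟ b)  t₂ = Σ (Term (Δp q) _) (λ t → FTr q t₁ a t × FTr q t b t₂)
    FTr q t₁ (a ∪ₐ b) t₂ = FTr q t₁ a t₂ ⊎ FTr q t₁ b t₂
    FTr q t₁ (a ⋆)    t₂ = Σ ℕ (λ n → FPow q t₁ a n t₂)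

    FPow : (q : Cond) {s : S} → Term (Δp q) s → Act L → ℕ → Term (Δp q) s → Set₁
    FPow q t₁ a zero          t₂ = fP q (t₁ ≐ t₂)
    FPow q t₁ a (suc zero)    t₂ = FTr q t₁ a t₂
    FPow q t₁ a (suc (suc n)) t₂ =
      Σ (Term (Δp q) _) (λ t → FPow q t₁ a (suc n) t × FTr q t a t₂)

  -- Forces q μ φ  means  q ⊩ μ(φ)   (μ : O' → Δ_q);
  -- this generalisation makes the clause for ¬ structurally recursive.
  mutual
    Forces : (q : Cond) {O' : Ops S L} → IMor O' (Δp q) → Sen O' → Set₂
    Forces q μ (t₁ ≐ t₂)      = Lift _ (fP q (trT μ t₁ ≐ trT μ t₂))
    Forces q μ (t₁ ⇒⟨ a ⟩ t₂) = Lift _ (FTr q (trT μ t₁) a (trT μ t₂))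
    Forces q {O'} μ (¬ₛ φ)    = ∀ r → (e : q ≼ r) → ¬ Forces r (_⨾_ {O₁ = O'} {O₂ = Δp q} {O₃ = Δp r} μ (incl {q} {r} e)) φ
    Forces q μ (⋁ₛ Φ)         = ForcesSome q μ Φ
    Forces q {O'} μ (∃ₛ X φ)  = Σ (Subst X (Δp q)) (λ θ → Forces q (withSubst {O₁ = O'} {O₂ = Δp q} X μ θ) φ)

    ForcesSome : (q : Cond) {O' : Ops S L} → IMor O' (Δp q) → List (Sen O') → Set₂
    ForcesSome q μ []      = Lift _ ⊥
    ForcesSome q μ (φ ∷ Φ) = Forces q μ φ ⊎ ForcesSome q μ Φ

  _⊩_ : (p : Cond) → Sen (Δp p) → Set₂
  p ⊩ φ = Forces p idI φ

  _⊩ʷ_ : (p : Cond) → Sen (Δp p) → Set₂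
  p ⊩ʷ φ = p ⊩ (¬ₛ ¬ₛ φ)

-- Both directions are proved for translated sentences, q ⊩ μ(φ), by induction on φ.
-- A forced sentence is derivable from Γ_q: at ¬ψ, if Γ_q ⊬ ¬ψ then Γ_q ∪ {ψ} is consistent,
-- hence a condition above q, and (by the converse) some extension of it forces ψ.
-- Conversely, if Γ_q ⊢ φ then φ is forced by some r ≥ q: add to Γ_q the sentence, one
-- consistent disjunct, or one consistent unfolding aⁿ of a star, and name the witnesses of
-- ∃ and the intermediate states of composite transitions by new constants of C, which exist
-- because C_q is finite. So no extension of p forces ¬φ exactly when Γ_p ⊢ φ, using ¬¬φ ⊢ φ.
-- Excluded middle decides consistency; countability of the sorts makes membership in the
-- finite sets of new constants decidable.
module Submission where

open import Defs
open import Level using (lift) renaming (suc to lsuc; zero to lzero; _⊔_ to _⊔ˡ_)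
open import Axiom.ExcludedMiddle using (ExcludedMiddle)
open import Axiom.DoubleNegationElimination using (em⇒dne)
open import Function.Base using (_∘_)
open import Function.Bundles using (_⇔_; mk⇔; Equivalence)
open import Data.Nat using (ℕ; zero; suc; _≤_; _<_; _⊔_)
open import Data.Nat.Properties using (≤-trans; ≤-refl; m≤m⊔n; m≤n⊔m; n≤1+n; <-irrefl) renaming (_≟_ to _≟ℕ_)
open import Data.Bool using (Bool; true; false; T; _∨_)
open import Data.Unit using (tt)
open import Data.Bool.Properties using (T-irrelevant; T-∨)
open import Data.Empty using (⊥-elim)
open import Data.Product using (Σ-syntax; _×_; _,_; proj₁; proj₂)
open import Data.Product.Properties using (≡-dec)
open import Data.Sum using (_⊎_; inj₁; inj₂)
open import Data.List using (List; []; _∷_; map; _++_)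
open import Data.List.Properties using (map-id)
open import Data.List.Membership.Propositional using (_∈_)
open import Data.List.Membership.Propositional.Properties using (∈-map⁺; ∈-++⁺ˡ; ∈-++⁺ʳ)
open import Data.List.Relation.Unary.Any using (here; there; any?)
open import Relation.Nullary using (¬_; yes; no)
open import Relation.Nullary.Decidable using (isYes; toWitness; fromWitness)
open import Relation.Binary.Definitions using (DecidableEquality)
open import Relation.Binary.PropositionalEquality
  using (_≡_; refl; sym; cong; cong₂; subst; subst₂; module ≡-Reasoning) renaming (trans to ≡-trans)
open import Relation.Binary.HeterogeneousEquality as H using (_≅_)
open import Axiom.UniquenessOfIdentityProofs.WithK using (uip)

module Translation {S L : Set} where

  -- IMor O₁ O₂ is a function type, from which O₁ and O₂ cannot be inferred;
  -- these variants take them explicitly.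
  trT[_,_] : (O₁ O₂ : Ops S L) {s : S} → IMor O₁ O₂ → Term O₁ s → Term O₂ s
  trT[ O₁ , O₂ ] μ t = trT {O₁ = O₁} {O₂ = O₂} μ t

  trTs[_,_] : (O₁ O₂ : Ops S L) {w : List S} → IMor O₁ O₂ → Terms O₁ w → Terms O₂ w
  trTs[ O₁ , O₂ ] μ ts = trTs {O₁ = O₁} {O₂ = O₂} μ ts

  trS[_,_] : (O₁ O₂ : Ops S L) → IMor O₁ O₂ → Sen O₁ → Sen O₂
  trS[ O₁ , O₂ ] μ φ = trS {O₁ = O₁} {O₂ = O₂} μ φ

  trSs[_,_] : (O₁ O₂ : Ops S L) → IMor O₁ O₂ → List (Sen O₁) → List (Sen O₂)
  trSs[ O₁ , O₂ ] μ Φ = trSs {O₁ = O₁} {O₂ = O₂} μ Φ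

  comp[_,_,_] : (O₁ O₂ O₃ : Ops S L) → IMor O₁ O₂ → IMor O₂ O₃ → IMor O₁ O₃
  comp[ O₁ , O₂ , O₃ ] μ ν = _⨾_ {O₁ = O₁} {O₂ = O₂} {O₃ = O₃} μ ν

  ext[_,_] : (O₁ O₂ : Ops S L) (X : List S) → IMor O₁ O₂ → IMor (O₁ [ X ]) (O₂ [ X ])
  ext[ O₁ , O₂ ] X μ = extI {O₁ = O₁} {O₂ = O₂} X μ

  withSubst[_,_] : (O₁ O₂ : Ops S L) (X : List S) → IMor O₁ O₂ → Subst X O₂ → IMor (O₁ [ X ]) O₂
  withSubst[ O₁ , O₂ ] X μ θ = withSubst {O₁ = O₁} {O₂ = O₂} X μ θ

  Image : Ops S L → List S → S → Set
  Image O w s = F O w s ⊎ (w ≡ [] × Term O s)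

  applyImage : (O : Ops S L) {w : List S} {s : S} → Image O w s → Terms O w → Term O s
  applyImage O (inj₁ g)          ts = op g ts
  applyImage O (inj₂ (refl , t)) [] = t

  -- A constant may be sent to itself as a symbol or as the term it forms;
  -- translations can only be compared up to identifying the two.
  data SameImage (O : Ops S L) : {w : List S} {s : S} → Image O w s → Image O w s → Set where
    same       : ∀ {w s} {x : Image O w s} → SameImage O x x
    const≈term : ∀ {s} (g : F O [] s) → SameImage O (inj₁ g) (inj₂ (refl , op g []))
    term≈const : ∀ {s} (g : F O [] s) → SameImage O (inj₂ (refl , op g [])) (inj₁ g)

  ≡⇒SameImage : (O : Ops S L) {w : List S} {s : S} {x y : Image O w s} → x ≡ y → SameImage O x y
  ≡⇒SameImage O refl = same

  SameImage-sym : (O : Ops S L) {w : List S} {s : S} {x y : Image O w s}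
                → SameImage O x y → SameImage O y x
  SameImage-sym O same           = same
  SameImage-sym O (const≈term g) = term≈const g
  SameImage-sym O (term≈const g) = const≈term g

  SameImage-trans : (O : Ops S L) {w : List S} {s : S} {x y z : Image O w s}
                  → SameImage O x y → SameImage O y z → SameImage O x z
  SameImage-trans O same           q                = q
  SameImage-trans O (const≈term g) same             = const≈term g
  SameImage-trans O (const≈term g) (term≈const .g) = same
  SameImage-trans O (term≈const g) same             = term≈const g
  SameImage-trans O (term≈const g) (const≈term .g) = same

  applyImage-cong : (O : Ops S L) {w : List S} {s : S} {x y : Image O w s} (ts : Terms O w)
                  → SameImage O x y → applyImage O x ts ≡ applyImage O y ts
  applyImage-cong O ts same           = refl
  applyImage-cong O [] (const≈term g) = refl
  applyImage-cong O [] (term≈const g) = refl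

  Equiv[_,_] : (O₁ O₂ : Ops S L) → IMor O₁ O₂ → IMor O₁ O₂ → Set
  Equiv[ O₁ , O₂ ] μ ν = ∀ {w s} (f : F O₁ w s) → SameImage O₂ (μ f) (ν f)

  Equiv-sym : (O₁ O₂ : Ops S L) {μ ν : IMor O₁ O₂} → Equiv[ O₁ , O₂ ] μ ν → Equiv[ O₁ , O₂ ] ν μ
  Equiv-sym O₁ O₂ μ≈ν f = SameImage-sym O₂ (μ≈ν f)

  Equiv-trans : (O₁ O₂ : Ops S L) {μ ν κ : IMor O₁ O₂}
              → Equiv[ O₁ , O₂ ] μ ν → Equiv[ O₁ , O₂ ] ν κ → Equiv[ O₁ , O₂ ] μ κ
  Equiv-trans O₁ O₂ μ≈ν ν≈κ f = SameImage-trans O₂ (μ≈ν f) (ν≈κ f)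

  trT-op : (O₁ O₂ : Ops S L) {w : List S} {s : S} (μ : IMor O₁ O₂) (f : F O₁ w s) (ts : Terms O₁ w)
         → trT[ O₁ , O₂ ] μ (op f ts) ≡ applyImage O₂ (μ f) (trTs[ O₁ , O₂ ] μ ts)
  trT-op O₁ O₂ μ f ts with μ f
  ... | inj₁ g = refl
  trT-op O₁ O₂ μ f [] | inj₂ (refl , t) = refl

  mutual
    trT-cong : (O₁ O₂ : Ops S L) {s : S} {μ ν : IMor O₁ O₂} → Equiv[ O₁ , O₂ ] μ ν
             → (t : Term O₁ s) → trT[ O₁ , O₂ ] μ t ≡ trT[ O₁ , O₂ ] ν t
    trT-cong O₁ O₂ {μ = μ} {ν} μ≈ν (op f ts) = begin
      trT[ O₁ , O₂ ] μ (op f ts)                      ≡⟨ trT-op O₁ O₂ μ f ts ⟩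
      applyImage O₂ (μ f) (trTs[ O₁ , O₂ ] μ ts)      ≡⟨ cong (applyImage O₂ (μ f)) (trTs-cong O₁ O₂ μ≈ν ts) ⟩
      applyImage O₂ (μ f) (trTs[ O₁ , O₂ ] ν ts)      ≡⟨ applyImage-cong O₂ _ (μ≈ν f) ⟩
      applyImage O₂ (ν f) (trTs[ O₁ , O₂ ] ν ts)      ≡⟨ trT-op O₁ O₂ ν f ts ⟨
      trT[ O₁ , O₂ ] ν (op f ts)                      ∎
      where open ≡-Reasoning

    trTs-cong : (O₁ O₂ : Ops S L) {w : List S} {μ ν : IMor O₁ O₂} → Equiv[ O₁ , O₂ ] μ ν
              → (ts : Terms O₁ w) → trTs[ O₁ , O₂ ] μ ts ≡ trTs[ O₁ , O₂ ] ν ts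
    trTs-cong O₁ O₂ μ≈ν []       = refl
    trTs-cong O₁ O₂ μ≈ν (t ∷ ts) = cong₂ _∷_ (trT-cong O₁ O₂ μ≈ν t) (trTs-cong O₁ O₂ μ≈ν ts)

  liftImage : (O : Ops S L) {w : List S} {s : S} (X : List S) → Image O w s → Image (O [ X ]) w s
  liftImage O X (inj₁ g)       = inj₁ (inj₁ g)
  liftImage O X (inj₂ (e , t)) = inj₂ (e , trT[ O , O [ X ] ] (ιI X) t)

  extI-inj₁ : (O₁ O₂ : Ops S L) {w : List S} {s : S} (X : List S) (μ : IMor O₁ O₂) (f : F O₁ w s)
            → ext[ O₁ , O₂ ] X μ (inj₁ f) ≡ liftImage O₂ X (μ f)
  extI-inj₁ O₁ O₂ X μ f with μ f
  ... | inj₁ g       = refl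
  ... | inj₂ (e , t) = refl

  liftImage-cong : (O : Ops S L) {w : List S} {s : S} (X : List S) {x y : Image O w s}
                 → SameImage O x y → SameImage (O [ X ]) (liftImage O X x) (liftImage O X y)
  liftImage-cong O X same           = same
  liftImage-cong O X (const≈term g) = const≈term (inj₁ g)
  liftImage-cong O X (term≈const g) = term≈const (inj₁ g)

  ext-cong : (O₁ O₂ : Ops S L) (X : List S) {μ ν : IMor O₁ O₂} → Equiv[ O₁ , O₂ ] μ ν
           → Equiv[ O₁ [ X ] , O₂ [ X ] ] (ext[ O₁ , O₂ ] X μ) (ext[ O₁ , O₂ ] X ν)
  ext-cong O₁ O₂ X {μ} {ν} μ≈ν (inj₁ f) =
    subst₂ (SameImage (O₂ [ X ])) (sym (extI-inj₁ O₁ O₂ X μ f)) (sym (extI-inj₁ O₁ O₂ X ν f))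
           (liftImage-cong O₂ X (μ≈ν f))
  ext-cong O₁ O₂ X μ≈ν (inj₂ x) = same

  mutual
    trS-cong : (O₁ O₂ : Ops S L) {μ ν : IMor O₁ O₂} → Equiv[ O₁ , O₂ ] μ ν
             → (φ : Sen O₁) → trS[ O₁ , O₂ ] μ φ ≡ trS[ O₁ , O₂ ] ν φ
    trS-cong O₁ O₂ μ≈ν (t₁ ≐ t₂)      = cong₂ _≐_ (trT-cong O₁ O₂ μ≈ν t₁) (trT-cong O₁ O₂ μ≈ν t₂)
    trS-cong O₁ O₂ μ≈ν (t₁ ⇒⟨ a ⟩ t₂) =
      cong₂ (λ u v → u ⇒⟨ a ⟩ v) (trT-cong O₁ O₂ μ≈ν t₁) (trT-cong O₁ O₂ μ≈ν t₂)
    trS-cong O₁ O₂ μ≈ν (¬ₛ φ)         = cong ¬ₛ_ (trS-cong O₁ O₂ μ≈ν φ)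
    trS-cong O₁ O₂ μ≈ν (⋁ₛ Φ)         = cong ⋁ₛ (trSs-cong O₁ O₂ μ≈ν Φ)
    trS-cong O₁ O₂ μ≈ν (∃ₛ X φ)       =
      cong (∃ₛ X) (trS-cong (O₁ [ X ]) (O₂ [ X ]) (ext-cong O₁ O₂ X μ≈ν) φ)

    trSs-cong : (O₁ O₂ : Ops S L) {μ ν : IMor O₁ O₂} → Equiv[ O₁ , O₂ ] μ ν
              → (Φ : List (Sen O₁)) → trSs[ O₁ , O₂ ] μ Φ ≡ trSs[ O₁ , O₂ ] ν Φ
    trSs-cong O₁ O₂ μ≈ν []      = refl
    trSs-cong O₁ O₂ μ≈ν (φ ∷ Φ) = cong₂ _∷_ (trS-cong O₁ O₂ μ≈ν φ) (trSs-cong O₁ O₂ μ≈ν Φ)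

  compImage : (O₂ O₃ : Ops S L) {w : List S} {s : S} → IMor O₂ O₃ → Image O₂ w s → Image O₃ w s
  compImage O₂ O₃ ν (inj₁ g)       = ν g
  compImage O₂ O₃ ν (inj₂ (e , t)) = inj₂ (e , trT[ O₂ , O₃ ] ν t)

  ⨾-apply : (O₁ O₂ O₃ : Ops S L) {w : List S} {s : S} (μ : IMor O₁ O₂) (ν : IMor O₂ O₃) (f : F O₁ w s)
          → comp[ O₁ , O₂ , O₃ ] μ ν f ≡ compImage O₂ O₃ ν (μ f)
  ⨾-apply O₁ O₂ O₃ μ ν f with μ f
  ... | inj₁ g       = refl
  ... | inj₂ (e , t) = refl

  trT-applyImage : (O₂ O₃ : Ops S L) {w : List S} {s : S} (ν : IMor O₂ O₃) (x : Image O₂ w s) (us : Terms O₂ w)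
                 → trT[ O₂ , O₃ ] ν (applyImage O₂ x us)
                   ≡ applyImage O₃ (compImage O₂ O₃ ν x) (trTs[ O₂ , O₃ ] ν us)
  trT-applyImage O₂ O₃ ν (inj₁ g)          us = trT-op O₂ O₃ ν g us
  trT-applyImage O₂ O₃ ν (inj₂ (refl , t)) [] = refl

  mutual
    trT-⨾ : (O₁ O₂ O₃ : Ops S L) {s : S} (μ : IMor O₁ O₂) (ν : IMor O₂ O₃) (t : Term O₁ s)
          → trT[ O₂ , O₃ ] ν (trT[ O₁ , O₂ ] μ t) ≡ trT[ O₁ , O₃ ] (comp[ O₁ , O₂ , O₃ ] μ ν) t
    trT-⨾ O₁ O₂ O₃ μ ν (op f ts) = begin
      trT[ O₂ , O₃ ] ν (trT[ O₁ , O₂ ] μ (op f ts))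
        ≡⟨ cong (trT[ O₂ , O₃ ] ν) (trT-op O₁ O₂ μ f ts) ⟩
      trT[ O₂ , O₃ ] ν (applyImage O₂ (μ f) (trTs[ O₁ , O₂ ] μ ts))
        ≡⟨ trT-applyImage O₂ O₃ ν (μ f) _ ⟩
      applyImage O₃ (compImage O₂ O₃ ν (μ f)) (trTs[ O₂ , O₃ ] ν (trTs[ O₁ , O₂ ] μ ts))
        ≡⟨ cong₂ (applyImage O₃) (sym (⨾-apply O₁ O₂ O₃ μ ν f)) (trTs-⨾ O₁ O₂ O₃ μ ν ts) ⟩
      applyImage O₃ (comp[ O₁ , O₂ , O₃ ] μ ν f) (trTs[ O₁ , O₃ ] (comp[ O₁ , O₂ , O₃ ] μ ν) ts)
        ≡⟨ trT-op O₁ O₃ (comp[ O₁ , O₂ , O₃ ] μ ν) f ts ⟨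
      trT[ O₁ , O₃ ] (comp[ O₁ , O₂ , O₃ ] μ ν) (op f ts) ∎
      where open ≡-Reasoning

    trTs-⨾ : (O₁ O₂ O₃ : Ops S L) {w : List S} (μ : IMor O₁ O₂) (ν : IMor O₂ O₃) (ts : Terms O₁ w)
           → trTs[ O₂ , O₃ ] ν (trTs[ O₁ , O₂ ] μ ts) ≡ trTs[ O₁ , O₃ ] (comp[ O₁ , O₂ , O₃ ] μ ν) ts
    trTs-⨾ O₁ O₂ O₃ μ ν []       = refl
    trTs-⨾ O₁ O₂ O₃ μ ν (t ∷ ts) = cong₂ _∷_ (trT-⨾ O₁ O₂ O₃ μ ν t) (trTs-⨾ O₁ O₂ O₃ μ ν ts)

  ⨾-congˡ : (O₁ O₂ O₃ : Ops S L) {μ μ' : IMor O₁ O₂} (ν : IMor O₂ O₃) → Equiv[ O₁ , O₂ ] μ μ'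
          → Equiv[ O₁ , O₃ ] (comp[ O₁ , O₂ , O₃ ] μ ν) (comp[ O₁ , O₂ , O₃ ] μ' ν)
  ⨾-congˡ O₁ O₂ O₃ {μ} {μ'} ν μ≈μ' f =
    subst₂ (SameImage O₃) (sym (⨾-apply O₁ O₂ O₃ μ ν f)) (sym (⨾-apply O₁ O₂ O₃ μ' ν f))
           (compImage-cong (μ≈μ' f))
    where
      compImage-cong : ∀ {w s} {x y : Image O₂ w s}
                     → SameImage O₂ x y → SameImage O₃ (compImage O₂ O₃ ν x) (compImage O₂ O₃ ν y)
      compImage-cong same = same
      compImage-cong (const≈term g) with ν g
      ... | inj₁ k          = const≈term k
      ... | inj₂ (refl , t) = same
      compImage-cong (term≈const g) with ν g
      ... | inj₁ k          = term≈const k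
      ... | inj₂ (refl , t) = same

  ⨾-congʳ : (O₁ O₂ O₃ : Ops S L) (μ : IMor O₁ O₂) {ν ν' : IMor O₂ O₃} → Equiv[ O₂ , O₃ ] ν ν'
          → Equiv[ O₁ , O₃ ] (comp[ O₁ , O₂ , O₃ ] μ ν) (comp[ O₁ , O₂ , O₃ ] μ ν')
  ⨾-congʳ O₁ O₂ O₃ μ {ν} {ν'} ν≈ν' f =
    subst₂ (SameImage O₃) (sym (⨾-apply O₁ O₂ O₃ μ ν f)) (sym (⨾-apply O₁ O₂ O₃ μ ν' f)) (pointwise (μ f))
    where
      pointwise : ∀ {w s} (x : Image O₂ w s) → SameImage O₃ (compImage O₂ O₃ ν x) (compImage O₂ O₃ ν' x)
      pointwise (inj₁ g)       = ν≈ν' g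
      pointwise (inj₂ (e , t)) = ≡⇒SameImage O₃ (cong (λ u → inj₂ (e , u)) (trT-cong O₂ O₃ ν≈ν' t))

  ⨾-assoc : (O₁ O₂ O₃ O₄ : Ops S L) (μ : IMor O₁ O₂) (ν : IMor O₂ O₃) (κ : IMor O₃ O₄)
          → Equiv[ O₁ , O₄ ] (comp[ O₁ , O₃ , O₄ ] (comp[ O₁ , O₂ , O₃ ] μ ν) κ)
                             (comp[ O₁ , O₂ , O₄ ] μ (comp[ O₂ , O₃ , O₄ ] ν κ))
  ⨾-assoc O₁ O₂ O₃ O₄ μ ν κ f = ≡⇒SameImage O₄ (begin
    comp[ O₁ , O₃ , O₄ ] (comp[ O₁ , O₂ , O₃ ] μ ν) κ f
      ≡⟨ ⨾-apply O₁ O₃ O₄ (comp[ O₁ , O₂ , O₃ ] μ ν) κ f ⟩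
    compImage O₃ O₄ κ (comp[ O₁ , O₂ , O₃ ] μ ν f)
      ≡⟨ cong (compImage O₃ O₄ κ) (⨾-apply O₁ O₂ O₃ μ ν f) ⟩
    compImage O₃ O₄ κ (compImage O₂ O₃ ν (μ f))
      ≡⟨ pointwise (μ f) ⟩
    compImage O₂ O₄ (comp[ O₂ , O₃ , O₄ ] ν κ) (μ f)
      ≡⟨ ⨾-apply O₁ O₂ O₄ μ (comp[ O₂ , O₃ , O₄ ] ν κ) f ⟨
    comp[ O₁ , O₂ , O₄ ] μ (comp[ O₂ , O₃ , O₄ ] ν κ) f ∎)
    where
      open ≡-Reasoning
      pointwise : ∀ {w s} (x : Image O₂ w s)
                → compImage O₃ O₄ κ (compImage O₂ O₃ ν x) ≡ compImage O₂ O₄ (comp[ O₂ , O₃ , O₄ ] ν κ) x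
      pointwise (inj₁ g)       = sym (⨾-apply O₂ O₃ O₄ ν κ g)
      pointwise (inj₂ (e , t)) = cong (λ u → inj₂ (e , u)) (trT-⨾ O₂ O₃ O₄ ν κ t)

  ι⨾ext≈⨾ι : (O₁ O₂ : Ops S L) (X : List S) (ν : IMor O₁ O₂)
           → Equiv[ O₁ , O₂ [ X ] ] (comp[ O₁ , O₁ [ X ] , O₂ [ X ] ] (ιI X) (ext[ O₁ , O₂ ] X ν))
                                     (comp[ O₁ , O₂ , O₂ [ X ] ] ν (ιI X))
  ι⨾ext≈⨾ι O₁ O₂ X ν g = ≡⇒SameImage (O₂ [ X ])
    (≡-trans (extI-inj₁ O₁ O₂ X ν g) (≡-trans (pointwise (ν g)) (sym (⨾-apply O₁ O₂ (O₂ [ X ]) ν (ιI X) g))))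
    where
      pointwise : ∀ {w s} (x : Image O₂ w s) → liftImage O₂ X x ≡ compImage O₂ (O₂ [ X ]) (ιI X) x
      pointwise (inj₁ k)       = refl
      pointwise (inj₂ (e , t)) = refl

  ext-⨾ : (O₁ O₂ O₃ : Ops S L) (X : List S) (μ : IMor O₁ O₂) (ν : IMor O₂ O₃)
        → Equiv[ O₁ [ X ] , O₃ [ X ] ]
            (comp[ O₁ [ X ] , O₂ [ X ] , O₃ [ X ] ] (ext[ O₁ , O₂ ] X μ) (ext[ O₂ , O₃ ] X ν))
                                         (ext[ O₁ , O₃ ] X (comp[ O₁ , O₂ , O₃ ] μ ν))
  ext-⨾ O₁ O₂ O₃ X μ ν (inj₁ f) = ≡⇒SameImage (O₃ [ X ]) (begin
    comp[ O₁ [ X ] , O₂ [ X ] , O₃ [ X ] ] (ext[ O₁ , O₂ ] X μ) (ext[ O₂ , O₃ ] X ν) (inj₁ f)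
      ≡⟨ ⨾-apply (O₁ [ X ]) (O₂ [ X ]) (O₃ [ X ]) (ext[ O₁ , O₂ ] X μ) (ext[ O₂ , O₃ ] X ν) (inj₁ f) ⟩
    compImage (O₂ [ X ]) (O₃ [ X ]) (ext[ O₂ , O₃ ] X ν) (ext[ O₁ , O₂ ] X μ (inj₁ f))
      ≡⟨ cong (compImage (O₂ [ X ]) (O₃ [ X ]) (ext[ O₂ , O₃ ] X ν)) (extI-inj₁ O₁ O₂ X μ f) ⟩
    compImage (O₂ [ X ]) (O₃ [ X ]) (ext[ O₂ , O₃ ] X ν) (liftImage O₂ X (μ f))
      ≡⟨ pointwise (μ f) ⟩
    liftImage O₃ X (compImage O₂ O₃ ν (μ f))
      ≡⟨ cong (liftImage O₃ X) (⨾-apply O₁ O₂ O₃ μ ν f) ⟨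
    liftImage O₃ X (comp[ O₁ , O₂ , O₃ ] μ ν f)
      ≡⟨ extI-inj₁ O₁ O₃ X (comp[ O₁ , O₂ , O₃ ] μ ν) f ⟨
    ext[ O₁ , O₃ ] X (comp[ O₁ , O₂ , O₃ ] μ ν) (inj₁ f) ∎)
    where
      open ≡-Reasoning
      pointwise : ∀ {w s} (x : Image O₂ w s)
                → compImage (O₂ [ X ]) (O₃ [ X ]) (ext[ O₂ , O₃ ] X ν) (liftImage O₂ X x)
                  ≡ liftImage O₃ X (compImage O₂ O₃ ν x)
      pointwise (inj₁ g)       = extI-inj₁ O₂ O₃ X ν g
      pointwise (inj₂ (e , t)) = cong (λ u → inj₂ (e , u)) (begin
        trT[ O₂ [ X ] , O₃ [ X ] ] (ext[ O₂ , O₃ ] X ν) (trT[ O₂ , O₂ [ X ] ] (ιI X) t)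
          ≡⟨ trT-⨾ O₂ (O₂ [ X ]) (O₃ [ X ]) (ιI X) (ext[ O₂ , O₃ ] X ν) t ⟩
        trT[ O₂ , O₃ [ X ] ] (comp[ O₂ , O₂ [ X ] , O₃ [ X ] ] (ιI X) (ext[ O₂ , O₃ ] X ν)) t
          ≡⟨ trT-cong O₂ (O₃ [ X ]) (ι⨾ext≈⨾ι O₂ O₃ X ν) t ⟩
        trT[ O₂ , O₃ [ X ] ] (comp[ O₂ , O₃ , O₃ [ X ] ] ν (ιI X)) t
          ≡⟨ trT-⨾ O₂ O₃ (O₃ [ X ]) ν (ιI X) t ⟨
        trT[ O₃ , O₃ [ X ] ] (ιI X) (trT[ O₂ , O₃ ] ν t) ∎)
  ext-⨾ O₁ O₂ O₃ X μ ν (inj₂ x) = same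

  mutual
    trS-⨾ : (O₁ O₂ O₃ : Ops S L) (μ : IMor O₁ O₂) (ν : IMor O₂ O₃) (φ : Sen O₁)
          → trS[ O₂ , O₃ ] ν (trS[ O₁ , O₂ ] μ φ) ≡ trS[ O₁ , O₃ ] (comp[ O₁ , O₂ , O₃ ] μ ν) φ
    trS-⨾ O₁ O₂ O₃ μ ν (t₁ ≐ t₂)      = cong₂ _≐_ (trT-⨾ O₁ O₂ O₃ μ ν t₁) (trT-⨾ O₁ O₂ O₃ μ ν t₂)
    trS-⨾ O₁ O₂ O₃ μ ν (t₁ ⇒⟨ a ⟩ t₂) =
      cong₂ (λ u v → u ⇒⟨ a ⟩ v) (trT-⨾ O₁ O₂ O₃ μ ν t₁) (trT-⨾ O₁ O₂ O₃ μ ν t₂)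
    trS-⨾ O₁ O₂ O₃ μ ν (¬ₛ φ)         = cong ¬ₛ_ (trS-⨾ O₁ O₂ O₃ μ ν φ)
    trS-⨾ O₁ O₂ O₃ μ ν (⋁ₛ Φ)         = cong ⋁ₛ (trSs-⨾ O₁ O₂ O₃ μ ν Φ)
    trS-⨾ O₁ O₂ O₃ μ ν (∃ₛ X φ)       = cong (∃ₛ X)
      (≡-trans (trS-⨾ (O₁ [ X ]) (O₂ [ X ]) (O₃ [ X ]) (ext[ O₁ , O₂ ] X μ) (ext[ O₂ , O₃ ] X ν) φ)
               (trS-cong (O₁ [ X ]) (O₃ [ X ]) (ext-⨾ O₁ O₂ O₃ X μ ν) φ))

    trSs-⨾ : (O₁ O₂ O₃ : Ops S L) (μ : IMor O₁ O₂) (ν : IMor O₂ O₃) (Φ : List (Sen O₁))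
           → trSs[ O₂ , O₃ ] ν (trSs[ O₁ , O₂ ] μ Φ) ≡ trSs[ O₁ , O₃ ] (comp[ O₁ , O₂ , O₃ ] μ ν) Φ
    trSs-⨾ O₁ O₂ O₃ μ ν []      = refl
    trSs-⨾ O₁ O₂ O₃ μ ν (φ ∷ Φ) = cong₂ _∷_ (trS-⨾ O₁ O₂ O₃ μ ν φ) (trSs-⨾ O₁ O₂ O₃ μ ν Φ)

  mutual
    trT-id : (O : Ops S L) {s : S} (t : Term O s) → trT[ O , O ] idI t ≡ t
    trT-id O (op f ts) = cong (op f) (trTs-id O ts)

    trTs-id : (O : Ops S L) {w : List S} (ts : Terms O w) → trTs[ O , O ] idI ts ≡ ts
    trTs-id O []       = refl
    trTs-id O (t ∷ ts) = cong₂ _∷_ (trT-id O t) (trTs-id O ts)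

  ext-id : (O : Ops S L) (X : List S) → Equiv[ O [ X ] , O [ X ] ] (ext[ O , O ] X idI) idI
  ext-id O X (inj₁ f) = same
  ext-id O X (inj₂ x) = same

  mutual
    trS-id : (O : Ops S L) (φ : Sen O) → trS[ O , O ] idI φ ≡ φ
    trS-id O (t₁ ≐ t₂)      = cong₂ _≐_ (trT-id O t₁) (trT-id O t₂)
    trS-id O (t₁ ⇒⟨ a ⟩ t₂) = cong₂ (λ u v → u ⇒⟨ a ⟩ v) (trT-id O t₁) (trT-id O t₂)
    trS-id O (¬ₛ φ)         = cong ¬ₛ_ (trS-id O φ)
    trS-id O (⋁ₛ Φ)         = cong ⋁ₛ (trSs-id O Φ)
    trS-id O (∃ₛ X φ)       =
      cong (∃ₛ X) (≡-trans (trS-cong (O [ X ]) (O [ X ]) (ext-id O X) φ) (trS-id (O [ X ]) φ))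

    trSs-id : (O : Ops S L) (Φ : List (Sen O)) → trSs[ O , O ] idI Φ ≡ Φ
    trSs-id O []      = refl
    trSs-id O (φ ∷ Φ) = cong₂ _∷_ (trS-id O φ) (trSs-id O Φ)

  ι⨾withSubst : (O₁ O₂ : Ops S L) (X : List S) (ν : IMor O₁ O₂) (θ : Subst X O₂)
              → Equiv[ O₁ , O₂ ] (comp[ O₁ , O₁ [ X ] , O₂ ] (ιI X) (withSubst[ O₁ , O₂ ] X ν θ)) ν
  ι⨾withSubst O₁ O₂ X ν θ f = same

  ext⨾withSubst : (O' O₁ O₂ : Ops S L) (X : List S) (μ : IMor O' O₁) (ν : IMor O₁ O₂) (θ : Subst X O₂)
                → Equiv[ O' [ X ] , O₂ ]
                    (comp[ O' [ X ] , O₁ [ X ] , O₂ ] (ext[ O' , O₁ ] X μ) (withSubst[ O₁ , O₂ ] X ν θ))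
                                         (withSubst[ O' , O₂ ] X (comp[ O' , O₁ , O₂ ] μ ν) θ)
  ext⨾withSubst O' O₁ O₂ X μ ν θ (inj₁ f) = ≡⇒SameImage O₂ (begin
    comp[ O' [ X ] , O₁ [ X ] , O₂ ] (ext[ O' , O₁ ] X μ) νθ (inj₁ f)
      ≡⟨ ⨾-apply (O' [ X ]) (O₁ [ X ]) O₂ (ext[ O' , O₁ ] X μ) νθ (inj₁ f) ⟩
    compImage (O₁ [ X ]) O₂ νθ (ext[ O' , O₁ ] X μ (inj₁ f))
      ≡⟨ cong (compImage (O₁ [ X ]) O₂ νθ) (extI-inj₁ O' O₁ X μ f) ⟩
    compImage (O₁ [ X ]) O₂ νθ (liftImage O₁ X (μ f))
      ≡⟨ pointwise (μ f) ⟩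
    compImage O₁ O₂ ν (μ f)
      ≡⟨ ⨾-apply O' O₁ O₂ μ ν f ⟨
    comp[ O' , O₁ , O₂ ] μ ν f ∎)
    where
      open ≡-Reasoning
      νθ = withSubst[ O₁ , O₂ ] X ν θ
      pointwise : ∀ {w s} (x : Image O₁ w s)
                → compImage (O₁ [ X ]) O₂ νθ (liftImage O₁ X x) ≡ compImage O₁ O₂ ν x
      pointwise (inj₁ g)       = refl
      pointwise (inj₂ (e , t)) = cong (λ u → inj₂ (e , u))
        (≡-trans (trT-⨾ O₁ (O₁ [ X ]) O₂ (ιI X) νθ t) (trT-cong O₁ O₂ (ι⨾withSubst O₁ O₂ X ν θ) t))
  ext⨾withSubst O' O₁ O₂ X μ ν θ (inj₂ x) = same

  withSubst⨾ : (O' O₁ O₂ : Ops S L) (X : List S) (μ : IMor O' O₁) (θ : Subst X O₁) (ν : IMor O₁ O₂)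
             → Equiv[ O' [ X ] , O₂ ] (comp[ O' [ X ] , O₁ , O₂ ] (withSubst[ O' , O₁ ] X μ θ) ν)
                                      (withSubst[ O' , O₂ ] X (comp[ O' , O₁ , O₂ ] μ ν) (λ x → trT[ O₁ , O₂ ] ν (θ x)))
  withSubst⨾ O' O₁ O₂ X μ θ ν (inj₁ f) = ≡⇒SameImage O₂
    (≡-trans (⨾-apply (O' [ X ]) O₁ O₂ (withSubst[ O' , O₁ ] X μ θ) ν (inj₁ f))
             (sym (⨾-apply O' O₁ O₂ μ ν f)))
  withSubst⨾ O' O₁ O₂ X μ θ ν (inj₂ x) = same

  ⨾-identityʳ : (O₁ O₂ : Ops S L) (μ : IMor O₁ O₂) → Equiv[ O₁ , O₂ ] (comp[ O₁ , O₂ , O₂ ] μ idI) μ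
  ⨾-identityʳ O₁ O₂ μ f =
    subst (λ x → SameImage O₂ x (μ f)) (sym (⨾-apply O₁ O₂ O₂ μ idI f)) (pointwise (μ f))
    where
      pointwise : ∀ {w s} (x : Image O₂ w s) → SameImage O₂ (compImage O₂ O₂ idI x) x
      pointwise (inj₁ g)       = same
      pointwise (inj₂ (e , t)) = ≡⇒SameImage O₂ (cong (λ u → inj₂ (e , u)) (trT-id O₂ t))

  withSubst-cong : (O₁ O₂ : Ops S L) (X : List S) {μ ν : IMor O₁ O₂} (θ : Subst X O₂) → Equiv[ O₁ , O₂ ] μ ν
                 → Equiv[ O₁ [ X ] , O₂ ] (withSubst[ O₁ , O₂ ] X μ θ) (withSubst[ O₁ , O₂ ] X ν θ)
  withSubst-cong O₁ O₂ X θ μ≈ν (inj₁ f) = μ≈ν f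
  withSubst-cong O₁ O₂ X θ μ≈ν (inj₂ x) = same

  trS-ext⨾withSubst : (O' O₁ O₂ : Ops S L) (X : List S) (μ : IMor O' O₁) (ν : IMor O₁ O₂) (θ : Subst X O₂)
                      (φ : Sen (O' [ X ]))
                    → trS[ O₁ [ X ] , O₂ ] (withSubst[ O₁ , O₂ ] X ν θ) (trS[ O' [ X ] , O₁ [ X ] ] (ext[ O' , O₁ ] X μ) φ)
                      ≡ trS[ O' [ X ] , O₂ ] (withSubst[ O' , O₂ ] X (comp[ O' , O₁ , O₂ ] μ ν) θ) φ
  trS-ext⨾withSubst O' O₁ O₂ X μ ν θ φ =
    ≡-trans (trS-⨾ (O' [ X ]) (O₁ [ X ]) O₂ (ext[ O' , O₁ ] X μ) (withSubst[ O₁ , O₂ ] X ν θ) φ)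
            (trS-cong (O' [ X ]) O₂ (ext⨾withSubst O' O₁ O₂ X μ ν θ) φ)

  record SymbolMap (O₁ O₂ : Ops S L) : Set where
    field
      onF : ∀ {w s} → F O₁ w s → F O₂ w s
      onM : ∀ {w s} {f : F O₁ w s} → M O₁ f → M O₂ (onF f)
  open SymbolMap public

  asIMor : (O₁ O₂ : Ops S L) → SymbolMap O₁ O₂ → IMor O₁ O₂
  asIMor O₁ O₂ σ f = inj₁ (onF σ f)

  IdSigMor : (O₁ O₂ : Ops S L) (onF' : ∀ {w s} → F O₁ w s → F O₂ (map (λ s → s) w) s)
           → (∀ {w s} {f : F O₁ w s} → M O₁ f → M O₂ (onF' f)) → SigMor O₁ O₂
  IdSigMor O₁ O₂ onF' onM' = record { σS = λ s → s ; σL = λ l → l ; σF = onF' ; σM = onM' }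

  -- The arity of a translated symbol is map id w, which is w only propositionally.
  asSigMor : (O₁ O₂ : Ops S L) → SymbolMap O₁ O₂ → SigMor O₁ O₂
  asSigMor O₁ O₂ σ = IdSigMor O₁ O₂ (λ {w} {s} f → castF (onF σ f)) (λ {w} {s} {f} m → castM (onM σ m))
    where
      castF : ∀ {w s} → F O₂ w s → F O₂ (map (λ s → s) w) s
      castF {w} {s} = subst (λ v → F O₂ v s) (sym (map-id w))
      castM : ∀ {w s} {g : F O₂ w s} → M O₂ g → M O₂ (castF g)
      castM {w} m with map (λ s → s) w | map-id w
      ... | .w | refl = m

  Agrees : (O₁ O₂' O₂ : Ops S L) → (∀ {w s} → F O₁ w s → F O₂' (map (λ s → s) w) s) → IMor O₁ O₂ → Set
  Agrees O₁ O₂' O₂ onF' μ = ∀ {w s} (f : F O₁ w s) → Σ[ g ∈ F O₂ w s ] (μ f ≡ inj₁ g × onF' f ≅ g)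

  op-≅ : (O : Ops S L) {w' w : List S} {s : S} → w' ≡ w → {g' : F O w' s} {g : F O w s} → g' ≅ g
       → {ts' : Terms O w'} {ts : Terms O w} → ts' ≅ ts → op g' ts' ≡ op g ts
  op-≅ O refl H.refl H.refl = refl

  ∷-≅ : (O : Ops S L) {w' w : List S} {s : S} → w' ≡ w → {t t' : Term O s} → t ≡ t'
      → {ts' : Terms O w'} {ts : Terms O w} → ts' ≅ ts
      → _≅_ {A = Terms O (s ∷ w')} (t ∷ ts') {B = Terms O (s ∷ w)} (t' ∷ ts)
  ∷-≅ O refl refl H.refl = H.refl

  inj₁-≅ : (O : Ops S L) {X' X : List S} → X' ≡ X → {w' w : List S} {s : S} → w' ≡ w
         → {a : F O w' s} {b : F O w s} → a ≅ b
         → _≅_ {A = F (O [ X' ]) w' s} (inj₁ a) {B = F (O [ X ]) w s} (inj₁ b)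
  inj₁-≅ O refl refl H.refl = H.refl

  inj₂-≅ : (O : Ops S L) {X' X : List S} → X' ≡ X → {s : S} {x' : s ∈ X'} {x : s ∈ X} → x' ≅ x
         → _≅_ {A = F (O [ X' ]) [] s} (inj₂ (refl , x')) {B = F (O [ X ]) [] s} (inj₂ (refl , x))
  inj₂-≅ O refl H.refl = H.refl

  ∃ₛ-≅ : (O : Ops S L) {X' X : List S} → X' ≡ X → {φ' : Sen (O [ X' ])} {φ : Sen (O [ X ])} → φ' ≅ φ
       → ∃ₛ X' φ' ≡ ∃ₛ X φ
  ∃ₛ-≅ O refl H.refl = refl

  ∈-map⁺-id : {X : List S} {s : S} (x : s ∈ X) → ∈-map⁺ (λ s → s) x ≅ x
  ∈-map⁺-id {s ∷ X} (here refl) = here-≅ (map-id X)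
    where
      here-≅ : ∀ {X' X} → X' ≡ X → _≅_ {A = s ∈ (s ∷ X')} (here refl) {B = s ∈ (s ∷ X)} (here refl)
      here-≅ refl = H.refl
  ∈-map⁺-id {s' ∷ X} (there x) = there-≅ (map-id X) (∈-map⁺-id x)
    where
      there-≅ : ∀ {X' X} → X' ≡ X → {x' : _ ∈ X'} {x : _ ∈ X} → x' ≅ x
              → _≅_ {A = _ ∈ (s' ∷ X')} (there x') {B = _ ∈ (s' ∷ X)} (there x)
      there-≅ refl H.refl = H.refl

  trA-id : (a : Act L) → trA {S₁ = S} {S₂ = S} (λ l → l) a ≡ a
  trA-id (lab l)  = refl
  trA-id (a ⨟ b)  = cong₂ _⨟_ (trA-id a) (trA-id b)
  trA-id (a ∪ₐ b) = cong₂ _∪ₐ_ (trA-id a) (trA-id b)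
  trA-id (a ⋆)    = cong _⋆ (trA-id a)

  module _ (O₁ O₂ : Ops S L) (onF' : ∀ {w s} → F O₁ w s → F O₂ (map (λ s → s) w) s)
           (onM' : ∀ {w s} {f : F O₁ w s} → M O₁ f → M O₂ (onF' f)) (μ : IMor O₁ O₂)
           (agree : Agrees O₁ O₂ O₂ onF' μ) where

    mutual
      trTg≡trT : {s : S} (t : Term O₁ s) → trTg (IdSigMor O₁ O₂ onF' onM') t ≡ trT[ O₁ , O₂ ] μ t
      trTg≡trT (op f ts) with agree f
      ... | g , μf≡g , onF'f≅g = ≡-trans (op-≅ O₂ (map-id _) onF'f≅g (trTsg≅trTs ts))
        (sym (≡-trans (trT-op O₁ O₂ μ f ts) (cong (λ x → applyImage O₂ x (trTs[ O₁ , O₂ ] μ ts)) μf≡g)))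

      trTsg≅trTs : {w : List S} (ts : Terms O₁ w) → trTsg (IdSigMor O₁ O₂ onF' onM') ts ≅ trTs[ O₁ , O₂ ] μ ts
      trTsg≅trTs []       = H.refl
      trTsg≅trTs (t ∷ ts) = ∷-≅ O₂ (map-id _) (trTg≡trT t) (trTsg≅trTs ts)

  mutual
    -- The target O₂' = O₂ is generalised for the quantifier case, where O₂' is O₂ [ map id X ].
    trSg≅trS : (O₁ O₂' O₂ : Ops S L) → O₂' ≡ O₂
             → (onF' : ∀ {w s} → F O₁ w s → F O₂' (map (λ s → s) w) s)
               (onM' : ∀ {w s} {f : F O₁ w s} → M O₁ f → M O₂' (onF' f)) (μ : IMor O₁ O₂)
             → Agrees O₁ O₂' O₂ onF' μ
             → (φ : Sen O₁) → trSg (IdSigMor O₁ O₂' onF' onM') φ ≅ trS[ O₁ , O₂ ] μ φ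
    trSg≅trS O₁ O₂ .O₂ refl onF' onM' μ agree (t₁ ≐ t₂) =
      H.≡-to-≅ (cong₂ _≐_ (trTg≡trT O₁ O₂ onF' onM' μ agree t₁) (trTg≡trT O₁ O₂ onF' onM' μ agree t₂))
    trSg≅trS O₁ O₂ .O₂ refl onF' onM' μ agree (t₁ ⇒⟨ a ⟩ t₂) = H.≡-to-≅ (≡-trans
      (cong (λ b → trTg σ t₁ ⇒⟨ b ⟩ trTg σ t₂) (trA-id a))
      (cong₂ (λ u v → u ⇒⟨ a ⟩ v) (trTg≡trT O₁ O₂ onF' onM' μ agree t₁)
                                  (trTg≡trT O₁ O₂ onF' onM' μ agree t₂)))
      where σ = IdSigMor O₁ O₂ onF' onM'
    trSg≅trS O₁ O₂ .O₂ refl onF' onM' μ agree (¬ₛ φ) =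
      H.cong ¬ₛ_ (trSg≅trS O₁ O₂ O₂ refl onF' onM' μ agree φ)
    trSg≅trS O₁ O₂ .O₂ refl onF' onM' μ agree (⋁ₛ Φ) =
      H.≡-to-≅ (cong ⋁ₛ (trSsg≡trSs O₁ O₂ onF' onM' μ agree Φ))
    trSg≅trS O₁ O₂ .O₂ refl onF' onM' μ agree (∃ₛ X φ) = H.≡-to-≅ (∃ₛ-≅ O₂ (map-id X)
      (trSg≅trS (O₁ [ X ]) (O₂ [ map (λ s → s) X ]) (O₂ [ X ]) (cong (O₂ [_]) (map-id X))
                (σF σX) (λ {w} {s} {f} m → σM σX {w} {s} {f} m) (ext[ O₁ , O₂ ] X μ) agreeX φ))
      where
        σX = extG X (IdSigMor O₁ O₂ onF' onM')
        agreeX : Agrees (O₁ [ X ]) (O₂ [ map (λ s → s) X ]) (O₂ [ X ]) (σF σX) (ext[ O₁ , O₂ ] X μ)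
        agreeX (inj₁ f) with agree f
        ... | g , μf≡g , onF'f≅g =
          inj₁ g , ≡-trans (extI-inj₁ O₁ O₂ X μ f) (cong (liftImage O₂ X) μf≡g) ,
          inj₁-≅ O₂ (map-id X) (map-id _) onF'f≅g
        agreeX (inj₂ (refl , x)) = inj₂ (refl , x) , refl , inj₂-≅ O₂ (map-id X) (∈-map⁺-id x)

    trSsg≡trSs : (O₁ O₂ : Ops S L) (onF' : ∀ {w s} → F O₁ w s → F O₂ (map (λ s → s) w) s)
                 (onM' : ∀ {w s} {f : F O₁ w s} → M O₁ f → M O₂ (onF' f)) (μ : IMor O₁ O₂)
               → Agrees O₁ O₂ O₂ onF' μ → (Φ : List (Sen O₁))
               → trSsg (IdSigMor O₁ O₂ onF' onM') Φ ≡ trSs[ O₁ , O₂ ] μ Φ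
    trSsg≡trSs O₁ O₂ onF' onM' μ agree []      = refl
    trSsg≡trSs O₁ O₂ onF' onM' μ agree (φ ∷ Φ) =
      cong₂ _∷_ (H.≅-to-≡ (trSg≅trS O₁ O₂ O₂ refl onF' onM' μ agree φ))
                (trSsg≡trSs O₁ O₂ onF' onM' μ agree Φ)

  trSg-asSigMor : (O₁ O₂ : Ops S L) (σ : SymbolMap O₁ O₂) (φ : Sen O₁)
                → trSg (asSigMor O₁ O₂ σ) φ ≡ trS[ O₁ , O₂ ] (asIMor O₁ O₂ σ) φ
  trSg-asSigMor O₁ O₂ σ φ = H.≅-to-≡ (trSg≅trS O₁ O₂ O₂ refl _ _ (asIMor O₁ O₂ σ)
    (λ {w} f → onF σ f , refl , H.≡-subst-removable (λ v → F O₂ v _) (sym (map-id w)) (onF σ f)) φ)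

  ⊢-translate : (O₁ O₂ : Ops S L) (σ : SymbolMap O₁ O₂) {Γ : SenSet O₁} {φ : Sen O₁}
              → Γ ⊢ φ
              → imageI {O₁ = O₁} {O₂ = O₂} (asIMor O₁ O₂ σ) Γ ⊢ trS[ O₁ , O₂ ] (asIMor O₁ O₂ σ) φ
  ⊢-translate O₁ O₂ σ {Γ} {φ} Γ⊢φ =
    subst (imageI {O₁ = O₁} {O₂ = O₂} (asIMor O₁ O₂ σ) Γ ⊢_) (trSg-asSigMor O₁ O₂ σ φ)
      (trans (λ { ψ (γ , γ∈Γ , eq) → mono (γ , γ∈Γ , ≡-trans (sym (trSg-asSigMor O₁ O₂ σ γ)) eq) })
             (transl (asSigMor O₁ O₂ σ) Γ⊢φ))

module SyntacticForcing {S L : Set} (O : Ops S L) (_≟ₛ_ : DecidableEquality S)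
                        (em : ExcludedMiddle (lsuc (lsuc lzero))) where
  open Translation {S} {L}
  open Forcing O

  Consistent : {O' : Ops S L} → SenSet O' → Set₂
  Consistent Γ' = ¬ (Γ' ⊢ ⊥ₛ)

  Extension : ∀ {ℓ} (q : Cond) → ((r : Cond) → q ≼ r → Set ℓ) → Set (lsuc (lsuc lzero) ⊔ˡ ℓ)
  Extension q P = Σ[ r ∈ Cond ] Σ[ e ∈ q ≼ r ] P r e

  inclT : ∀ {q r} {s : S} → q ≼ r → Term (Δp q) s → Term (Δp r) s
  inclT {q} {r} e t = trT[ Δp q , Δp r ] (incl {q} {r} e) t

  inclS : ∀ {q r} → q ≼ r → Sen (Δp q) → Sen (Δp r)
  inclS {q} {r} e φ = trS[ Δp q , Δp r ] (incl {q} {r} e) φ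

  inclC-irrelevant : (C₁ C₂ : S → ℕ → Bool) (a b : ∀ s n → T (C₁ s n) → T (C₂ s n))
                   → Equiv[ Δ C₁ , Δ C₂ ] (inclC a) (inclC b)
  inclC-irrelevant C₁ C₂ a b (inj₁ f)           = same
  inclC-irrelevant C₁ C₂ a b (inj₂ (e , n , c)) =
    ≡⇒SameImage (Δ C₂) (cong (λ c' → inj₁ (inj₂ (e , n , c'))) (T-irrelevant _ _))

  inclC-⨾ : (C₁ C₂ C₃ : S → ℕ → Bool) (a : ∀ s n → T (C₁ s n) → T (C₂ s n))
            (b : ∀ s n → T (C₂ s n) → T (C₃ s n)) (c : ∀ s n → T (C₁ s n) → T (C₃ s n))
          → Equiv[ Δ C₁ , Δ C₃ ] (comp[ Δ C₁ , Δ C₂ , Δ C₃ ] (inclC a) (inclC b)) (inclC c)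
  inclC-⨾ C₁ C₂ C₃ a b c (inj₁ f)           = same
  inclC-⨾ C₁ C₂ C₃ a b c (inj₂ (e , n , x)) =
    ≡⇒SameImage (Δ C₃) (cong (λ c' → inj₁ (inj₂ (e , n , c'))) (T-irrelevant _ _))

  inclC-id : (C : S → ℕ → Bool) (a : ∀ s n → T (C s n) → T (C s n)) → Equiv[ Δ C , Δ C ] (inclC a) idI
  inclC-id C a (inj₁ f)           = same
  inclC-id C a (inj₂ (e , n , c)) =
    ≡⇒SameImage (Δ C) (cong (λ c' → inj₁ (inj₂ (e , n , c'))) (T-irrelevant _ _))

  trS-inclC-id : (C : S → ℕ → Bool) (a : ∀ s n → T (C s n) → T (C s n)) (γ : Sen (Δ C))
               → trS[ Δ C , Δ C ] (inclC a) γ ≡ γ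
  trS-inclC-id C a γ = ≡-trans (trS-cong (Δ C) (Δ C) (inclC-id C a) γ) (trS-id (Δ C) γ)

  ≼-refl : ∀ q → q ≼ q
  ≼-refl q = record
    { sub = λ s n c → c
    ; sup = λ γ γ∈Γ → subst (Γ q) (sym (trS-inclC-id (Cp q) _ γ)) γ∈Γ }

  ≼-trans : ∀ {q r u} → q ≼ r → r ≼ u → q ≼ u
  ≼-trans {q} {r} {u} q≼r r≼u = record
    { sub = λ s n c → sub r≼u s n (sub q≼r s n c)
    ; sup = λ γ γ∈Γ → subst (Γ u)
        (≡-trans (trS-⨾ (Δp q) (Δp r) (Δp u) (incl q≼r) (incl r≼u) γ)
                 (trS-cong (Δp q) (Δp u) (inclC-⨾ (Cp q) (Cp r) (Cp u) _ _ _) γ))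
        (sup r≼u _ (sup q≼r γ γ∈Γ)) }

  incl-⨾ : ∀ {q r u} (q≼r : q ≼ r) (r≼u : r ≼ u)
         → Equiv[ Δp q , Δp u ] (comp[ Δp q , Δp r , Δp u ] (incl q≼r) (incl r≼u)) (incl (≼-trans q≼r r≼u))
  incl-⨾ {q} {r} {u} _ _ = inclC-⨾ (Cp q) (Cp r) (Cp u) _ _ _

  inclT-⨾ : ∀ {q r u} (q≼r : q ≼ r) (r≼u : r ≼ u) {s : S} (t : Term (Δp q) s)
          → inclT r≼u (inclT q≼r t) ≡ inclT (≼-trans q≼r r≼u) t
  inclT-⨾ {q} {r} {u} q≼r r≼u t =
    ≡-trans (trT-⨾ (Δp q) (Δp r) (Δp u) _ _ t) (trT-cong (Δp q) (Δp u) (incl-⨾ q≼r r≼u) t)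

  inclT-⨾⨾ : ∀ {q r u v} (q≼r : q ≼ r) (r≼u : r ≼ u) (u≼v : u ≼ v) {s : S} (t : Term (Δp q) s)
           → inclT u≼v (inclT r≼u (inclT q≼r t)) ≡ inclT (≼-trans (≼-trans q≼r r≼u) u≼v) t
  inclT-⨾⨾ q≼r r≼u u≼v t =
    ≡-trans (cong (inclT u≼v) (inclT-⨾ q≼r r≼u t)) (inclT-⨾ (≼-trans q≼r r≼u) u≼v t)

  ⨾-incl-⨾ : ∀ {O' : Ops S L} {q r u} (μ : IMor O' (Δp q)) (q≼r : q ≼ r) (r≼u : r ≼ u)
           → Equiv[ O' , Δp u ] (comp[ O' , Δp r , Δp u ] (comp[ O' , Δp q , Δp r ] μ (incl q≼r)) (incl r≼u))
                                (comp[ O' , Δp q , Δp u ] μ (incl (≼-trans q≼r r≼u)))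
  ⨾-incl-⨾ {O'} {q} {r} {u} μ q≼r r≼u =
    Equiv-trans O' (Δp u) (⨾-assoc O' (Δp q) (Δp r) (Δp u) μ _ _) (⨾-congʳ O' (Δp q) (Δp u) μ (incl-⨾ q≼r r≼u))

  mutual
    Forces-cong : ∀ q {O' : Ops S L} {μ ν : IMor O' (Δp q)} → Equiv[ O' , Δp q ] μ ν
                → (φ : Sen O') → Forces q μ φ → Forces q ν φ
    Forces-cong q {O'} μ≈ν (t₁ ≐ t₂) (lift q⊩) =
      lift (subst (fP q) (cong₂ _≐_ (trT-cong O' (Δp q) μ≈ν t₁) (trT-cong O' (Δp q) μ≈ν t₂)) q⊩)
    Forces-cong q {O'} μ≈ν (t₁ ⇒⟨ a ⟩ t₂) (lift q⊩) =
      lift (subst₂ (λ u v → FTr q u a v) (trT-cong O' (Δp q) μ≈ν t₁) (trT-cong O' (Δp q) μ≈ν t₂) q⊩)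
    Forces-cong q {O'} μ≈ν (¬ₛ φ) q⊩¬φ r e r⊩φ =
      q⊩¬φ r e (Forces-cong r (⨾-congˡ O' (Δp q) (Δp r) (incl e) (Equiv-sym O' (Δp q) μ≈ν)) φ r⊩φ)
    Forces-cong q μ≈ν (⋁ₛ Φ) q⊩Φ = ForcesSome-cong q μ≈ν Φ q⊩Φ
    Forces-cong q {O'} μ≈ν (∃ₛ X φ) (θ , q⊩φ) = θ , Forces-cong q (withSubst-cong O' (Δp q) X θ μ≈ν) φ q⊩φ

    ForcesSome-cong : ∀ q {O' : Ops S L} {μ ν : IMor O' (Δp q)} → Equiv[ O' , Δp q ] μ ν
                    → (Φ : List (Sen O')) → ForcesSome q μ Φ → ForcesSome q ν Φ
    ForcesSome-cong q μ≈ν []      ()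
    ForcesSome-cong q μ≈ν (φ ∷ Φ) (inj₁ q⊩φ) = inj₁ (Forces-cong q μ≈ν φ q⊩φ)
    ForcesSome-cong q μ≈ν (φ ∷ Φ) (inj₂ q⊩Φ) = inj₂ (ForcesSome-cong q μ≈ν Φ q⊩Φ)

  cut : ∀ {O' : Ops S L} {Γ' : SenSet O'} {α φ : Sen O'} → Γ' ⊢ α → (Γ' ∪｛ α ｝) ⊢ φ → Γ' ⊢ φ
  cut Γ'⊢α Γ'α⊢φ = trans (λ { ψ (inj₁ ψ∈Γ') → mono ψ∈Γ' ; ψ (inj₂ refl) → Γ'⊢α }) Γ'α⊢φ

  ⊢-weaken : ∀ {O' : Ops S L} {A B : SenSet O'} {φ : Sen O'} → (∀ ψ → A ψ → B ψ) → A ⊢ φ → B ⊢ φ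
  ⊢-weaken A⊆B A⊢φ = trans (λ ψ ψ∈A → mono (A⊆B ψ ψ∈A)) A⊢φ

  inclSymbolMap : ∀ {q r} → q ≼ r → SymbolMap (Δp q) (Δp r)
  inclSymbolMap {q} {r} e = record { onF = onF' ; onM = λ {w} {s} {f} m → onM' {w} {s} {f} m }
    where
      onF' : ∀ {w s} → F (Δp q) w s → F (Δp r) w s
      onF' (inj₁ f)                     = inj₁ f
      onF' {s = s} (inj₂ (e' , n , c)) = inj₂ (e' , n , sub e s n c)
      onM' : ∀ {w s} {f : F (Δp q) w s} → M (Δp q) f → M (Δp r) (onF' f)
      onM' {f = inj₁ f} m = m
      onM' {f = inj₂ _} ()

  inclSymbolMap≈incl : ∀ {q r} (e : q ≼ r) → Equiv[ Δp q , Δp r ] (asIMor (Δp q) (Δp r) (inclSymbolMap e)) (incl e)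
  inclSymbolMap≈incl e (inj₁ f) = same
  inclSymbolMap≈incl e (inj₂ x) = same

  ⊢-incl : ∀ {q r} (e : q ≼ r) {φ : Sen (Δp q)} → Γ q ⊢ φ → Γ r ⊢ inclS e φ
  ⊢-incl {q} {r} e {φ} Γq⊢φ = subst (Γ r ⊢_) (asIMor≡incl φ)
    (trans (λ { ψ (γ , γ∈Γq , refl) → mono (subst (Γ r) (sym (asIMor≡incl γ)) (sup e γ γ∈Γq)) })
           (⊢-translate (Δp q) (Δp r) (inclSymbolMap e) Γq⊢φ))
    where
      asIMor≡incl : ∀ γ → trS[ Δp q , Δp r ] (asIMor (Δp q) (Δp r) (inclSymbolMap e)) γ ≡ inclS e γ
      asIMor≡incl = trS-cong (Δp q) (Δp r) (inclSymbolMap≈incl e)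

  extendCond : ∀ q (E : SenSet (Δp q)) → Consistent (λ ψ → Γ q ψ ⊎ E ψ)
             → Extension q (λ r e → ∀ ψ → E ψ → Γ r (inclS e ψ))
  extendCond q E consistent = r , q≼r , λ ψ ψ∈E → inj₂ (subst E (sym (trS-inclC-id (Cp q) _ ψ)) ψ∈E)
    where
      r : Cond
      r = record { Cp = Cp q ; Cp-fin = Cp-fin q ; Γ = λ ψ → Γ q ψ ⊎ E ψ ; consis = consistent }
      q≼r : q ≼ r
      q≼r = record
        { sub = λ s n c → c
        ; sup = λ γ γ∈Γ → inj₁ (subst (Γ q) (sym (trS-inclC-id (Cp q) _ γ)) γ∈Γ) }

  extendCond-singleton : ∀ q {φ : Sen (Δp q)} → Consistent (Γ q ∪｛ φ ｝) → Extension q (λ r e → Γ r (inclS e φ))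
  extendCond-singleton q {φ} consistent with extendCond q ｛ φ ｝ consistent
  ... | r , e , E⊆Γr = r , e , E⊆Γr φ refl

  indexBound : List (S × ℕ) → ℕ
  indexBound []             = 0
  indexBound ((s , n) ∷ xs) = suc n ⊔ indexBound xs

  index<indexBound : ∀ {s n xs} → (s , n) ∈ xs → n < indexBound xs
  index<indexBound {s} {n} {(.s , .n) ∷ xs} (here refl) = m≤m⊔n (suc n) (indexBound xs)
  index<indexBound {xs = (s' , n') ∷ xs}    (there m)   =
    ≤-trans (index<indexBound m) (m≤n⊔m (suc n') (indexBound xs))

  -- For N above every constant of C_q, the variables of X become the new constants N, N+1, ….
  freshList : ℕ → List S → List (S × ℕ)
  freshList N []      = []
  freshList N (s ∷ X) = (s , N) ∷ freshList (suc N) X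

  freshIndex : ∀ {s} {X : List S} → ℕ → s ∈ X → ℕ
  freshIndex N (here _)  = N
  freshIndex N (there x) = freshIndex (suc N) x

  freshIndex∈freshList : ∀ {s} {X : List S} N (x : s ∈ X) → (s , freshIndex N x) ∈ freshList N X
  freshIndex∈freshList N (here refl) = here refl
  freshIndex∈freshList N (there x)   = there (freshIndex∈freshList (suc N) x)

  freshList-variable : ∀ {s n} {X : List S} N → (s , n) ∈ freshList N X → s ∈ X
  freshList-variable {X = s' ∷ X} N (here eq) = here (cong proj₁ eq)
  freshList-variable {X = s' ∷ X} N (there m) = there (freshList-variable (suc N) m)

  freshList-≥ : ∀ {s n} {X : List S} N → (s , n) ∈ freshList N X → N ≤ n
  freshList-≥ {X = s' ∷ X} N (here refl) = ≤-refl
  freshList-≥ {X = s' ∷ X} N (there m)   = ≤-trans (n≤1+n N) (freshList-≥ (suc N) m)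

  freshIndex-≥ : ∀ {s} {X : List S} N (x : s ∈ X) → N ≤ freshIndex N x
  freshIndex-≥ N (here _)  = ≤-refl
  freshIndex-≥ N (there x) = ≤-trans (n≤1+n N) (freshIndex-≥ (suc N) x)

  freshList-∈-unique : ∀ {p} {X : List S} N (m m' : p ∈ freshList N X) → m ≡ m'
  freshList-∈-unique {X = s' ∷ X} N (here eq)   (here eq')  = cong here (uip eq eq')
  freshList-∈-unique {X = s' ∷ X} N (here refl) (there m')  = ⊥-elim (<-irrefl refl (freshList-≥ (suc N) m'))
  freshList-∈-unique {X = s' ∷ X} N (there m)   (here refl) = ⊥-elim (<-irrefl refl (freshList-≥ (suc N) m))
  freshList-∈-unique {X = s' ∷ X} N (there m)   (there m')  = cong there (freshList-∈-unique (suc N) m m')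

  freshList-variable-freshIndex : ∀ {s} {X : List S} N (x : s ∈ X)
                                → freshList-variable N (freshIndex∈freshList N x) ≡ x
  freshList-variable-freshIndex N (here refl) = refl
  freshList-variable-freshIndex N (there x)   = cong there (freshList-variable-freshIndex (suc N) x)

  module FreshConstants (q : Cond) (X : List S) where

    N : ℕ
    N = indexBound (proj₁ (Cp-fin q))

    isFresh : S → ℕ → Bool
    isFresh s n = isYes (any? (≡-dec _≟ₛ_ _≟ℕ_ (s , n)) (freshList N X))

    Cp⁺ : S → ℕ → Bool
    Cp⁺ s n = Cp q s n ∨ isFresh s n

    Cp⊆Cp⁺ : ∀ s n → T (Cp q s n) → T (Cp⁺ s n)
    Cp⊆Cp⁺ s n c = Equivalence.from T-∨ (inj₁ c)

    Cp⁺-fin : Σ[ xs ∈ List (S × ℕ) ] (∀ s n → T (Cp⁺ s n) → (s , n) ∈ xs)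
    Cp⁺-fin = proj₁ (Cp-fin q) ++ freshList N X , support
      where
        support : ∀ s n → T (Cp⁺ s n) → (s , n) ∈ (proj₁ (Cp-fin q) ++ freshList N X)
        support s n c with Equivalence.to (T-∨ {Cp q s n}) c
        ... | inj₁ old   = ∈-++⁺ˡ (proj₂ (Cp-fin q) s n old)
        ... | inj₂ fresh = ∈-++⁺ʳ (proj₁ (Cp-fin q)) (toWitness fresh)

    Δ⁺ : Ops S L
    Δ⁺ = Δ Cp⁺

    Δq[X] : Ops S L
    Δq[X] = Δp q [ X ]

    ι⁺ : IMor (Δp q) Δ⁺
    ι⁺ = inclC Cp⊆Cp⁺

    freshSubst : Subst X Δ⁺
    freshSubst {s} x = op (inj₂ (refl , freshIndex N x , fresh)) []
      where fresh = Equivalence.from (T-∨ {Cp q s _}) (inj₂ (fromWitness (freshIndex∈freshList N x)))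

    instantiate : IMor Δq[X] Δ⁺
    instantiate = withSubst[ Δp q , Δ⁺ ] X ι⁺ freshSubst

    unfreshenConst : ∀ s n (b : Bool) → b ≡ Cp q s n → T (b ∨ isFresh s n) → F Δq[X] [] s
    unfreshenConst s n true  eq c = inj₁ (inj₂ (refl , n , subst T eq tt))
    unfreshenConst s n false eq c = inj₂ (refl , freshList-variable N (toWitness c))

    unfreshenF : ∀ {w s} → F Δ⁺ w s → F Δq[X] w s
    unfreshenF (inj₁ f)                    = inj₁ (inj₁ f)
    unfreshenF {s = s} (inj₂ (refl , n , c)) = unfreshenConst s n (Cp q s n) refl c

    unfreshen : SymbolMap Δ⁺ Δq[X]
    unfreshen = record { onF = unfreshenF ; onM = λ {w} {s} {f} m → unfreshenM {w} {s} {f} m }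
      where
        unfreshenM : ∀ {w s} {f : F Δ⁺ w s} → M Δ⁺ f → M Δq[X] (unfreshenF f)
        unfreshenM {f = inj₁ f}          m = m
        unfreshenM {f = inj₂ (refl , _)} ()

    unfreshenI : IMor Δ⁺ Δq[X]
    unfreshenI = asIMor Δ⁺ Δq[X] unfreshen

    unfreshenConst-old : ∀ {s n} (b : Bool) (eq : b ≡ Cp q s n) c (old : T (Cp q s n))
                       → unfreshenConst s n b eq c ≡ inj₁ (inj₂ (refl , n , old))
    unfreshenConst-old true  eq c old = cong (λ c' → inj₁ (inj₂ (refl , _ , c'))) (T-irrelevant _ _)
    unfreshenConst-old false eq c old = ⊥-elim (subst T (sym eq) old)

    unfreshenConst-fresh : ∀ {s} (x : s ∈ X) (b : Bool) (eq : b ≡ Cp q s (freshIndex N x)) c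
                         → unfreshenConst s (freshIndex N x) b eq c ≡ inj₂ (refl , x)
    unfreshenConst-fresh {s} x true eq c = ⊥-elim (<-irrefl refl
      (≤-trans (index<indexBound (proj₂ (Cp-fin q) s _ (subst T eq tt))) (freshIndex-≥ N x)))
    unfreshenConst-fresh x false eq c = cong (λ x' → inj₂ (refl , x'))
      (≡-trans (cong (freshList-variable N) (freshList-∈-unique N _ (freshIndex∈freshList N x)))
               (freshList-variable-freshIndex N x))

    ι⁺⨾unfreshen≈ιX : Equiv[ Δp q , Δq[X] ] (comp[ Δp q , Δ⁺ , Δq[X] ] ι⁺ unfreshenI) (ιI X)
    ι⁺⨾unfreshen≈ιX (inj₁ f) = same
    ι⁺⨾unfreshen≈ιX {s = s} (inj₂ (refl , n , c)) =
      ≡⇒SameImage Δq[X] (cong inj₁ (unfreshenConst-old (Cp q s n) refl (Cp⊆Cp⁺ s n c) c))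

    instantiate⨾unfreshen≈id : Equiv[ Δq[X] , Δq[X] ] (comp[ Δq[X] , Δ⁺ , Δq[X] ] instantiate unfreshenI) idI
    instantiate⨾unfreshen≈id (inj₁ (inj₁ f)) = same
    instantiate⨾unfreshen≈id {s = s} (inj₁ (inj₂ (refl , n , c))) =
      ≡⇒SameImage Δq[X] (cong inj₁ (unfreshenConst-old (Cp q s n) refl (Cp⊆Cp⁺ s n c) c))
    instantiate⨾unfreshen≈id {s = s} (inj₂ (refl , x)) =
      subst (λ g → SameImage Δq[X] (inj₂ (refl , op g [])) (inj₁ (inj₂ (refl , x))))
            (sym (unfreshenConst-fresh x (Cp q s (freshIndex N x)) refl _)) (term≈const (inj₂ (refl , x)))

    -- Consistency is inherited because renaming the fresh constants back into the variables X
    -- (unfreshen) maps the new Γ into Γ_q[X] ∪ E.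
    extendFresh : (E : SenSet Δq[X]) → Consistent (λ ψ → imageI (ιI X) (Γ q) ψ ⊎ E ψ)
                → Extension q (λ r e → Σ[ θ ∈ Subst X (Δp r) ]
                    (∀ ψ → E ψ → Γ r (trS[ Δq[X] , Δp r ] (withSubst[ Δp q , Δp r ] X (incl e) θ) ψ)))
    extendFresh E consistent = r , q≼r , freshSubst , λ ψ ψ∈E → inj₂ (ψ , ψ∈E , refl)
      where
        Γr : SenSet Δ⁺
        Γr ψ = imageI {O₁ = Δp q} {O₂ = Δ⁺} ι⁺ (Γ q) ψ ⊎ imageI {O₁ = Δq[X]} {O₂ = Δ⁺} instantiate E ψ

        unfreshen-Γr : ∀ ψ → imageI {O₁ = Δ⁺} {O₂ = Δq[X]} unfreshenI Γr ψ
                     → (λ ψ → imageI (ιI X) (Γ q) ψ ⊎ E ψ) ⊢ ψ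
        unfreshen-Γr _ (_ , inj₁ (γ , γ∈Γq , refl) , refl) = mono (inj₁ (γ , γ∈Γq , (begin
          trS[ Δp q , Δq[X] ] (ιI X) γ
            ≡⟨ trS-cong (Δp q) Δq[X] ι⁺⨾unfreshen≈ιX γ ⟨
          trS[ Δp q , Δq[X] ] (comp[ Δp q , Δ⁺ , Δq[X] ] ι⁺ unfreshenI) γ
            ≡⟨ trS-⨾ (Δp q) Δ⁺ Δq[X] ι⁺ unfreshenI γ ⟨
          trS[ Δ⁺ , Δq[X] ] unfreshenI (trS[ Δp q , Δ⁺ ] ι⁺ γ) ∎)))
          where open ≡-Reasoning
        unfreshen-Γr _ (_ , inj₂ (χ , χ∈E , refl) , refl) = mono (inj₂ (subst E (begin
          χ
            ≡⟨ trS-id Δq[X] χ ⟨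
          trS[ Δq[X] , Δq[X] ] idI χ
            ≡⟨ trS-cong Δq[X] Δq[X] instantiate⨾unfreshen≈id χ ⟨
          trS[ Δq[X] , Δq[X] ] (comp[ Δq[X] , Δ⁺ , Δq[X] ] instantiate unfreshenI) χ
            ≡⟨ trS-⨾ Δq[X] Δ⁺ Δq[X] instantiate unfreshenI χ ⟨
          trS[ Δ⁺ , Δq[X] ] unfreshenI (trS[ Δq[X] , Δ⁺ ] instantiate χ) ∎) χ∈E))
          where open ≡-Reasoning

        r : Cond
        r = record { Cp = Cp⁺ ; Cp-fin = Cp⁺-fin ; Γ = Γr
                   ; consis = λ Γr⊢⊥ → consistent (trans unfreshen-Γr (⊢-translate Δ⁺ Δq[X] unfreshen Γr⊢⊥)) }

        q≼r : q ≼ r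
        q≼r = record { sub = Cp⊆Cp⁺ ; sup = λ γ γ∈Γq → inj₁ (γ , γ∈Γq , refl) }

  mutual
    FTr-mono : ∀ {q r} (e : q ≼ r) {s : S} (t₁ t₂ : Term (Δp q) s) (a : Act L)
             → FTr q t₁ a t₂ → FTr r (inclT e t₁) a (inclT e t₂)
    FTr-mono e t₁ t₂ (lab l)  (g , _)      = sup e _ g , at-lab _ _ l
    FTr-mono e t₁ t₂ (a ⨟ b)  (t , x , y)  = inclT e t , FTr-mono e t₁ t a x , FTr-mono e t t₂ b y
    FTr-mono e t₁ t₂ (a ∪ₐ b) (inj₁ x)     = inj₁ (FTr-mono e t₁ t₂ a x)
    FTr-mono e t₁ t₂ (a ∪ₐ b) (inj₂ x)     = inj₂ (FTr-mono e t₁ t₂ b x)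
    FTr-mono e t₁ t₂ (a ⋆)    (n , x)      = n , FPow-mono e t₁ t₂ a n x

    FPow-mono : ∀ {q r} (e : q ≼ r) {s : S} (t₁ t₂ : Term (Δp q) s) (a : Act L) (n : ℕ)
              → FPow q t₁ a n t₂ → FPow r (inclT e t₁) a n (inclT e t₂)
    FPow-mono e t₁ t₂ a zero          (g , _)     = sup e _ g , at-eq _ _
    FPow-mono e t₁ t₂ a (suc zero)    x           = FTr-mono e t₁ t₂ a x
    FPow-mono e t₁ t₂ a (suc (suc n)) (t , x , y) = inclT e t , FPow-mono e t₁ t a (suc n) x , FTr-mono e t t₂ a y

  mutual
    FTr⇒⊢ : ∀ q {s : S} (t₁ t₂ : Term (Δp q) s) (a : Act L) → FTr q t₁ a t₂ → Γ q ⊢ t₁ ⇒⟨ a ⟩ t₂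
    FTr⇒⊢ q t₁ t₂ (lab l)  (g , _)     = mono g
    FTr⇒⊢ q t₁ t₂ (a ⨟ b)  (t , x , y) = CompI (FTr⇒⊢ q t₁ t a x) (FTr⇒⊢ q t t₂ b y)
    FTr⇒⊢ q t₁ t₂ (a ∪ₐ b) (inj₁ x)    = UnionI₁ (FTr⇒⊢ q t₁ t₂ a x)
    FTr⇒⊢ q t₁ t₂ (a ∪ₐ b) (inj₂ x)    = UnionI₂ (FTr⇒⊢ q t₁ t₂ b x)
    FTr⇒⊢ q t₁ t₂ (a ⋆)    (n , x)     = StarI n (FPow⇒⊢ q t₁ t₂ a n x)

    FPow⇒⊢ : ∀ q {s : S} (t₁ t₂ : Term (Δp q) s) (a : Act L) (n : ℕ)
           → FPow q t₁ a n t₂ → Γ q ⊢ transPow t₁ a n t₂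
    FPow⇒⊢ q t₁ t₂ a zero          (g , _)     = mono g
    FPow⇒⊢ q t₁ t₂ a (suc zero)    x           = FTr⇒⊢ q t₁ t₂ a x
    FPow⇒⊢ q t₁ t₂ a (suc (suc n)) (t , x , y) = CompI (FPow⇒⊢ q t₁ t a (suc n) x) (FTr⇒⊢ q t t₂ a y)

  inclS-transPow : ∀ {q r} (e : q ≼ r) {s : S} (u₁ u₂ : Term (Δp q) s) (a : Act L) (n : ℕ)
                 → inclS e (transPow u₁ a n u₂) ≡ transPow (inclT e u₁) a n (inclT e u₂)
  inclS-transPow e u₁ u₂ a zero    = refl
  inclS-transPow e u₁ u₂ a (suc n) = refl

  -- The intermediate state is named by a fresh constant; Comp_E shows that Γ_q stays consistent.
  ⊢⨟-split : ∀ q {s : S} (u₁ u₂ : Term (Δp q) s) (a b : Act L) → Γ q ⊢ u₁ ⇒⟨ a ⨟ b ⟩ u₂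
           → Extension q (λ r e → Σ[ c ∈ Term (Δp r) s ]
                                    (Γ r ⊢ inclT e u₁ ⇒⟨ a ⟩ c) × (Γ r ⊢ c ⇒⟨ b ⟩ inclT e u₂))
  ⊢⨟-split q {s} u₁ u₂ a b Γq⊢u₁⇒u₂ with FreshConstants.extendFresh q (s ∷ []) E consistent
    where
      ι = ιI {O = Δp q} (s ∷ [])
      x : Term (Δp q [ s ∷ [] ]) s
      x = op (inj₂ (refl , here refl)) []
      ι-T = trT[ Δp q , Δp q [ s ∷ [] ] ] ι
      E : SenSet (Δp q [ s ∷ [] ])
      E ψ = (ψ ≡ ι-T u₁ ⇒⟨ a ⟩ x) ⊎ (ψ ≡ x ⇒⟨ b ⟩ ι-T u₂)
      consistent : Consistent (λ ψ → imageI ι (Γ q) ψ ⊎ E ψ)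
      consistent Γ∪E⊢⊥ = consis q (CompE Γq⊢u₁⇒u₂ (⊢-weaken
        (λ { ψ (inj₁ ψ∈Γ)        → inj₁ (inj₁ ψ∈Γ)
           ; ψ (inj₂ (inj₁ refl)) → inj₁ (inj₂ refl)
           ; ψ (inj₂ (inj₂ refl)) → inj₂ refl })
        Γ∪E⊢⊥))
  ... | r , e , θ , E⊆Γr =
    r , e , θ (here refl) ,
    mono (subst (Γ r) (cong (λ u → u ⇒⟨ a ⟩ θ (here refl)) (instantiate-ι u₁)) (E⊆Γr _ (inj₁ refl))) ,
    mono (subst (Γ r) (cong (λ u → θ (here refl) ⇒⟨ b ⟩ u) (instantiate-ι u₂)) (E⊆Γr _ (inj₂ refl)))
    where
      X = s ∷ []
      instantiate-ι : (u : Term (Δp q) s)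
                    → trT[ Δp q [ X ] , Δp r ] (withSubst[ Δp q , Δp r ] X (incl e) θ) (trT[ Δp q , Δp q [ X ] ] (ιI X) u)
                      ≡ inclT e u
      instantiate-ι u = ≡-trans (trT-⨾ (Δp q) (Δp q [ X ]) (Δp r) (ιI X) (withSubst[ Δp q , Δp r ] X (incl e) θ) u)
                                (trT-cong (Δp q) (Δp r) (ι⨾withSubst (Δp q) (Δp r) X (incl e) θ) u)

  dne : {P : Set₂} → ¬ ¬ P → P
  dne = em⇒dne em

  FTr-above : ∀ q {s : S} → Term (Δp q) s → Act L → Term (Δp q) s → Set₂
  FTr-above q u₁ a u₂ = Extension q (λ r e → FTr r (inclT e u₁) a (inclT e u₂))

  FPow-above : ∀ q {s : S} → Term (Δp q) s → Act L → ℕ → Term (Δp q) s → Set₂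
  FPow-above q u₁ a n u₂ = Extension q (λ r e → FPow r (inclT e u₁) a n (inclT e u₂))

  -- Shared by composites a ⨟ b and powers aⁿ⁺² = aⁿ⁺¹ ⨟ a; taking the forcing of each half as an
  -- argument keeps the recursion below structural.
  ⊢⨟⇒above : ∀ q {s : S} (u₁ u₂ : Term (Δp q) s) (a b : Act L)
             (P : ∀ r → Term (Δp r) s → Term (Δp r) s → Set₁)
           → (∀ {r r'} (e : r ≼ r') (t₁ t₂ : Term (Δp r) s) → P r t₁ t₂ → P r' (inclT e t₁) (inclT e t₂))
           → (∀ r (v₁ v₂ : Term (Δp r) s) → Γ r ⊢ v₁ ⇒⟨ a ⟩ v₂
               → Extension r (λ r' e → P r' (inclT e v₁) (inclT e v₂)))
           → (∀ r (v₁ v₂ : Term (Δp r) s) → Γ r ⊢ v₁ ⇒⟨ b ⟩ v₂ → FTr-above r v₁ b v₂)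
           → Γ q ⊢ u₁ ⇒⟨ a ⨟ b ⟩ u₂
           → Extension q (λ r e → Σ[ t ∈ Term (Δp r) s ] P r (inclT e u₁) t × FTr r t b (inclT e u₂))
  ⊢⨟⇒above q u₁ u₂ a b P P-mono force₁ force₂ Γq⊢ with ⊢⨟-split q u₁ u₂ a b Γq⊢
  ... | r₁ , e₁ , c , Γr₁⊢a , Γr₁⊢b with force₁ r₁ _ _ Γr₁⊢a
  ...   | r₂ , e₂ , P₁ with force₂ r₂ _ _ (⊢-incl e₂ Γr₁⊢b)
  ...     | r₃ , e₃ , F₂ =
    r₃ , ≼-trans (≼-trans e₁ e₂) e₃ , inclT e₃ (inclT e₂ c) ,
    subst (λ t → P r₃ t _) (inclT-⨾⨾ e₁ e₂ e₃ u₁) (P-mono e₃ _ _ P₁) ,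
    subst (λ t → FTr r₃ _ b t) (inclT-⨾⨾ e₁ e₂ e₃ u₂) F₂

  mutual
    ⊢⇒FTr-above : ∀ q {s : S} (u₁ u₂ : Term (Δp q) s) (a : Act L)
                → Γ q ⊢ u₁ ⇒⟨ a ⟩ u₂ → FTr-above q u₁ a u₂
    ⊢⇒FTr-above q u₁ u₂ (lab l) Γq⊢ with extendCond-singleton q (λ Γq,u⊢⊥ → consis q (cut Γq⊢ Γq,u⊢⊥))
    ... | r , e , ∈Γr = r , e , ∈Γr , at-lab _ _ l
    ⊢⇒FTr-above q u₁ u₂ (a ∪ₐ b) Γq⊢ with em {Consistent (Γ q ∪｛ u₁ ⇒⟨ a ⟩ u₂ ｝)}
                                       | em {Consistent (Γ q ∪｛ u₁ ⇒⟨ b ⟩ u₂ ｝)}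
    ... | yes consistent | _ with assume-FTr-above q u₁ u₂ a consistent
    ...   | r , e , F = r , e , inj₁ F
    ⊢⇒FTr-above q u₁ u₂ (a ∪ₐ b) Γq⊢ | no _ | yes consistent with assume-FTr-above q u₁ u₂ b consistent
    ...   | r , e , F = r , e , inj₂ F
    ⊢⇒FTr-above q u₁ u₂ (a ∪ₐ b) Γq⊢ | no inconsistent₁ | no inconsistent₂ =
      ⊥-elim (consis q (UnionE Γq⊢ (dne inconsistent₁) (dne inconsistent₂)))
    ⊢⇒FTr-above q u₁ u₂ (a ⨟ b) Γq⊢ =
      ⊢⨟⇒above q u₁ u₂ a b (λ r t₁ t₂ → FTr r t₁ a t₂) (λ e t₁ t₂ → FTr-mono e t₁ t₂ a)
               (λ r v₁ v₂ → ⊢⇒FTr-above r v₁ v₂ a) (λ r v₁ v₂ → ⊢⇒FTr-above r v₁ v₂ b) Γq⊢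
    ⊢⇒FTr-above q u₁ u₂ (a ⋆) Γq⊢ with em {Σ[ n ∈ ℕ ] Consistent (Γ q ∪｛ transPow u₁ a n u₂ ｝)}
    ... | no noneConsistent =
      ⊥-elim (consis q (StarE Γq⊢ (λ n → dne (λ consistent → noneConsistent (n , consistent)))))
    ... | yes (n , consistent) with extendCond-singleton q consistent
    ...   | r₁ , e₁ , ∈Γr₁
      with ⊢⇒FPow-above r₁ _ _ a n (mono (subst (Γ r₁) (inclS-transPow e₁ u₁ u₂ a n) ∈Γr₁))
    ...     | r₂ , e₂ , F = r₂ , ≼-trans e₁ e₂ , n ,
      subst₂ (λ t₁ t₂ → FPow r₂ t₁ a n t₂) (inclT-⨾ e₁ e₂ u₁) (inclT-⨾ e₁ e₂ u₂) F

    assume-FTr-above : ∀ q {s : S} (u₁ u₂ : Term (Δp q) s) (a : Act L)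
                     → Consistent (Γ q ∪｛ u₁ ⇒⟨ a ⟩ u₂ ｝) → FTr-above q u₁ a u₂
    assume-FTr-above q u₁ u₂ a consistent with extendCond-singleton q consistent
    ... | r₁ , e₁ , ∈Γr₁ with ⊢⇒FTr-above r₁ _ _ a (mono ∈Γr₁)
    ...   | r₂ , e₂ , F = r₂ , ≼-trans e₁ e₂ ,
      subst₂ (λ t₁ t₂ → FTr r₂ t₁ a t₂) (inclT-⨾ e₁ e₂ u₁) (inclT-⨾ e₁ e₂ u₂) F

    ⊢⇒FPow-above : ∀ q {s : S} (u₁ u₂ : Term (Δp q) s) (a : Act L) (n : ℕ)
                 → Γ q ⊢ transPow u₁ a n u₂ → FPow-above q u₁ a n u₂
    ⊢⇒FPow-above q u₁ u₂ a zero Γq⊢ with extendCond-singleton q (λ Γq,u⊢⊥ → consis q (cut Γq⊢ Γq,u⊢⊥))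
    ... | r , e , ∈Γr = r , e , ∈Γr , at-eq _ _
    ⊢⇒FPow-above q u₁ u₂ a (suc zero) Γq⊢ = ⊢⇒FTr-above q u₁ u₂ a Γq⊢
    ⊢⇒FPow-above q u₁ u₂ a (suc (suc m)) Γq⊢ =
      ⊢⨟⇒above q u₁ u₂ (actPow a m) a
               (λ r t₁ t₂ → FPow r t₁ a (suc m) t₂) (λ e t₁ t₂ → FPow-mono e t₁ t₂ a (suc m))
               (λ r v₁ v₂ → ⊢⇒FPow-above r v₁ v₂ a (suc m)) (λ r v₁ v₂ → ⊢⇒FTr-above r v₁ v₂ a) Γq⊢

  Forces-above : ∀ q {O' : Ops S L} → IMor O' (Δp q) → Sen O' → Set₂
  Forces-above q {O'} μ φ = Extension q (λ r e → Forces r (comp[ O' , Δp q , Δp r ] μ (incl e)) φ)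

  ForcesSome-above : ∀ q {O' : Ops S L} → IMor O' (Δp q) → List (Sen O') → Set₂
  ForcesSome-above q {O'} μ Φ = Extension q (λ r e → ForcesSome r (comp[ O' , Δp q , Δp r ] μ (incl e)) Φ)

  trS-⨾incl : ∀ {q r} {O' : Ops S L} (μ : IMor O' (Δp q)) (e : q ≼ r) (φ : Sen O')
            → inclS e (trS[ O' , Δp q ] μ φ) ≡ trS[ O' , Δp r ] (comp[ O' , Δp q , Δp r ] μ (incl e)) φ
  trS-⨾incl {q} {r} {O'} μ e φ = trS-⨾ O' (Δp q) (Δp r) μ (incl e) φ

  mutual
    Forces⇒⊢ : ∀ q {O' : Ops S L} (μ : IMor O' (Δp q)) (φ : Sen O') → Forces q μ φ → Γ q ⊢ trS[ O' , Δp q ] μ φ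
    Forces⇒⊢ q μ (t₁ ≐ t₂)      (lift (t₁≐t₂∈Γq , _)) = mono t₁≐t₂∈Γq
    Forces⇒⊢ q μ (t₁ ⇒⟨ a ⟩ t₂) (lift q⊩)              = FTr⇒⊢ q _ _ a q⊩
    Forces⇒⊢ q {O'} μ (¬ₛ ψ) q⊩¬ψ with em {Γ q ⊢ ¬ₛ trS[ O' , Δp q ] μ ψ}
    ... | yes Γq⊢¬ψ = Γq⊢¬ψ
    ... | no Γq⊬¬ψ with assume-Forces-above q μ ψ (λ Γq,ψ⊢⊥ → Γq⊬¬ψ (NegI Γq,ψ⊢⊥))
    ...   | r , e , r⊩ψ = ⊥-elim (q⊩¬ψ r e r⊩ψ)
    Forces⇒⊢ q μ (⋁ₛ Φ) q⊩Φ = ForcesSome⇒⊢ q μ Φ q⊩Φ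
    Forces⇒⊢ q {O'} μ (∃ₛ X ψ) (θ , q⊩θψ) =
      SubstR θ (subst (Γ q ⊢_) θψ≡ (Forces⇒⊢ q (withSubst[ O' , Δp q ] X μ θ) ψ q⊩θψ))
      where
        θψ≡ : trS[ O' [ X ] , Δp q ] (withSubst[ O' , Δp q ] X μ θ) ψ
              ≡ applySubst X θ (trS[ O' [ X ] , Δp q [ X ] ] (ext[ O' , Δp q ] X μ) ψ)
        θψ≡ = sym (≡-trans (trS-ext⨾withSubst O' (Δp q) (Δp q) X μ idI θ ψ)
                           (trS-cong (O' [ X ]) (Δp q) (withSubst-cong O' (Δp q) X θ (⨾-identityʳ O' (Δp q) μ)) ψ))

    ForcesSome⇒⊢ : ∀ q {O' : Ops S L} (μ : IMor O' (Δp q)) (Φ : List (Sen O'))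
                 → ForcesSome q μ Φ → Γ q ⊢ ⋁ₛ (trSs[ O' , Δp q ] μ Φ)
    ForcesSome⇒⊢ q μ []      ()
    ForcesSome⇒⊢ q μ (φ ∷ Φ) (inj₁ q⊩φ) = DisjI (Forces⇒⊢ q μ φ q⊩φ) (here refl)
    ForcesSome⇒⊢ q μ (φ ∷ Φ) (inj₂ q⊩Φ) =
      DisjE (ForcesSome⇒⊢ q μ Φ q⊩Φ) (λ ψ ψ∈Φ → DisjI (mono (inj₂ refl)) (there ψ∈Φ))

    assume-Forces-above : ∀ q {O' : Ops S L} (μ : IMor O' (Δp q)) (φ : Sen O')
                        → Consistent (Γ q ∪｛ trS[ O' , Δp q ] μ φ ｝) → Forces-above q μ φ
    assume-Forces-above q {O'} μ φ consistent with extendCond-singleton q consistent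
    ... | r₁ , e₁ , μφ∈Γr₁ with ⊢⇒Forces-above r₁ _ φ (mono (subst (Γ r₁) (trS-⨾incl μ e₁ φ) μφ∈Γr₁))
    ...   | r₂ , e₂ , r₂⊩φ = r₂ , ≼-trans e₁ e₂ , Forces-cong r₂ (⨾-incl-⨾ {O'} μ e₁ e₂) φ r₂⊩φ

    ⊢⇒Forces-above : ∀ q {O' : Ops S L} (μ : IMor O' (Δp q)) (φ : Sen O') → Γ q ⊢ trS[ O' , Δp q ] μ φ
                   → Forces-above q μ φ
    ⊢⇒Forces-above q {O'} μ (t₁ ≐ t₂) Γq⊢
      with extendCond-singleton q (λ Γq,φ⊢⊥ → consis q (cut Γq⊢ Γq,φ⊢⊥))
    ... | r , e , φ∈Γr = r , e , lift (subst (Γ r) (trS-⨾incl μ e (t₁ ≐ t₂)) φ∈Γr , at-eq _ _)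
    ⊢⇒Forces-above q {O'} μ (t₁ ⇒⟨ a ⟩ t₂) Γq⊢ with ⊢⇒FTr-above q _ _ a Γq⊢
    ... | r , e , F = r , e , lift (subst₂ (λ u₁ u₂ → FTr r u₁ a u₂)
      (trT-⨾ O' (Δp q) (Δp r) μ (incl e) t₁) (trT-⨾ O' (Δp q) (Δp r) μ (incl e) t₂) F)
    ⊢⇒Forces-above q {O'} μ (¬ₛ ψ) Γq⊢¬ψ = q , ≼-refl q , λ r e r⊩ψ →
      consis r (cut (Forces⇒⊢ r _ ψ r⊩ψ) (NegE (subst (λ χ → Γ r ⊢ ¬ₛ χ) (μψ≡ r e) (⊢-incl e Γq⊢¬ψ))))
      where
        μψ≡ : ∀ r (e : q ≼ r) → inclS e (trS[ O' , Δp q ] μ ψ)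
              ≡ trS[ O' , Δp r ] (comp[ O' , Δp q , Δp r ] (comp[ O' , Δp q , Δp q ] μ (incl (≼-refl q))) (incl e)) ψ
        μψ≡ r e = ≡-trans (trS-⨾incl μ e ψ)
          (trS-cong O' (Δp r) (Equiv-trans O' (Δp r) (⨾-congʳ O' (Δp q) (Δp r) μ (inclC-irrelevant (Cp q) (Cp r) _ _))
                                            (Equiv-sym O' (Δp r) (⨾-incl-⨾ {O'} μ (≼-refl q) e))) ψ)
    ⊢⇒Forces-above q μ (⋁ₛ Φ) Γq⊢Φ = ⊢⇒ForcesSome-above q μ Φ Γq⊢Φ
    ⊢⇒Forces-above q {O'} μ (∃ₛ X ψ) Γq⊢∃ψ
      with FreshConstants.extendFresh q X ｛ trS[ O' [ X ] , Δp q [ X ] ] (ext[ O' , Δp q ] X μ) ψ ｝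
                                          (λ Γq,ψ⊢⊥ → consis q (cut Γq⊢∃ψ (QuantI Γq,ψ⊢⊥)))
    ... | r₁ , e₁ , θ , ψ∈Γr₁
      with ⊢⇒Forces-above r₁ (withSubst[ O' , Δp r₁ ] X (comp[ O' , Δp q , Δp r₁ ] μ (incl e₁)) θ) ψ
             (mono (subst (Γ r₁) (trS-ext⨾withSubst O' (Δp q) (Δp r₁) X μ (incl e₁) θ ψ) (ψ∈Γr₁ _ refl)))
    ...   | r₂ , e₂ , r₂⊩ψ = r₂ , ≼-trans e₁ e₂ , inclT e₂ ∘ θ , Forces-cong r₂ reassociate ψ r₂⊩ψ
      where
        reassociate = Equiv-trans (O' [ X ]) (Δp r₂) (withSubst⨾ O' (Δp r₁) (Δp r₂) X _ θ (incl e₂))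
                                  (withSubst-cong O' (Δp r₂) X (inclT e₂ ∘ θ) (⨾-incl-⨾ {O'} μ e₁ e₂))

    ⊢⇒ForcesSome-above : ∀ q {O' : Ops S L} (μ : IMor O' (Δp q)) (Φ : List (Sen O'))
                       → Γ q ⊢ ⋁ₛ (trSs[ O' , Δp q ] μ Φ) → ForcesSome-above q μ Φ
    ⊢⇒ForcesSome-above q μ [] Γq⊢⊥ = ⊥-elim (consis q Γq⊢⊥)
    ⊢⇒ForcesSome-above q {O'} μ (φ ∷ Φ) Γq⊢φ∨Φ with em {Consistent (Γ q ∪｛ trS[ O' , Δp q ] μ φ ｝)}
    ... | yes consistent with assume-Forces-above q μ φ consistent
    ...   | r , e , r⊩φ = r , e , inj₁ r⊩φ
    ⊢⇒ForcesSome-above q {O'} μ (φ ∷ Φ) Γq⊢φ∨Φ | no inconsistent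
      with ⊢⇒ForcesSome-above q μ Φ (DisjE Γq⊢φ∨Φ drop-φ)
      where
        drop-φ : ∀ ψ → ψ ∈ trSs[ O' , Δp q ] μ (φ ∷ Φ) → (Γ q ∪｛ ψ ｝) ⊢ ⋁ₛ (trSs[ O' , Δp q ] μ Φ)
        drop-φ ψ (here refl) = trans (λ { _ refl → dne inconsistent }) False
        drop-φ ψ (there ψ∈Φ) = DisjI (mono (inj₂ refl)) ψ∈Φ
    ...   | r , e , r⊩Φ = r , e , inj₂ r⊩Φ

  weakForcing⇔derivability : (p : Cond) (φ : Sen (Δp p)) → (p ⊩ʷ φ) ⇔ (Γ p ⊢ φ)
  weakForcing⇔derivability p φ = mk⇔ sound complete
    where
      sound : p ⊩ʷ φ → Γ p ⊢ φ
      sound p⊩¬¬φ =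
        trans (λ { _ refl → subst (Γ p ⊢_) (trS-id (Δp p) (¬ₛ ¬ₛ φ)) (Forces⇒⊢ p idI (¬ₛ ¬ₛ φ) p⊩¬¬φ) }) NegD
      complete : Γ p ⊢ φ → p ⊩ʷ φ
      complete Γp⊢φ q e q⊩¬φ with ⊢⇒Forces-above q (incl e) φ (⊢-incl e Γp⊢φ)
      ... | r , e' , r⊩φ = q⊩¬φ r e' (Forces-cong r id⨾incl≈incl φ r⊩φ)
        where
          id⨾incl≈incl = ⨾-congˡ (Δp p) (Δp q) (Δp r)
            {μ = incl e} {μ' = comp[ Δp p , Δp p , Δp q ] idI (incl e)} (incl e') (λ f → same)

decidableEquality-fromCountable : {A : Set} → Countable A → DecidableEquality A
decidableEquality-fromCountable (code , code-injective) a b with code a ≟ℕ code b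
... | yes codes≡ = yes (code-injective codes≡)
... | no codes≢  = no (λ a≡b → codes≢ (cong code a≡b))

theorem5p1 : ExcludedMiddle (lsuc (lsuc lzero))
    → (Σ' : Sig) → AtMostCountable Σ'
    → (p : Forcing.Cond (ops Σ')) → (φ : Sen (Forcing.Δp (ops Σ') p))
    → (Forcing._⊩ʷ_ (ops Σ') p φ) ⇔ (Forcing.Cond.Γ p ⊢ φ)
theorem5p1 em Σ' (sorts-countable , _) =
  SyntacticForcing.weakForcing⇔derivability (ops Σ') (decidableEquality-fromCountable sorts-countable) em
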